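{- Let $F(z)=\sum_{n\ge 0} I_n z^n$, where $I_n$ is the number of inversion sequences of length $n$ avoiding each of the patterns $100$, $102$, $201$ and $210$ (equivalently, with no indices $i<j<k$ such that $a_i>a_j$ and $a_i\ne a_k$), with $I_0=1$. Then \[ F(z)=\frac{(1-4z)(1-2z)(3-2z)-(1-8z+12z^2-2z^3)\sqrt{1-4z}}{2(1-z)^2(1-4z)} = 1+z+2z^2+6z^3+21z^4+76z^5+277z^6+1016z^7+\cdots. \]
   Context: An inversion sequence of length $n$ is an integer sequence $(a_1,\dots,a_n)$ with $0\le a_i<i$ for all $i$. A pattern is a sequence of non-negative integers containing every value from $0$ to its maximum. The reduction of a sequence of non-negative integers replaces its smallest entries by $0$, the next smallest by $1$, and so on. A sequence $a$ contains a pattern $\sigma$ of length $k$ if some (not necessarily consecutive) subsequence $a_{i_1}\cdots a_{i_k}$, $i_1<\dots<i_k$, has reduction $\sigma$; otherwise it avoids $\sigma$. The empty sequence is the unique inversion sequence of length $0$. -}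

module Defs where

open import Data.Nat as ℕ using (ℕ; zero; suc; _<?_; _∸_)
open import Data.Integer as ℤ using (ℤ; +_) renaming (_+_ to _+ℤ_; _*_ to _*ℤ_; _-_ to _-ℤ_)
open import Data.List using (List; []; _∷_; _++_; map; length; filter; deduplicate; concatMap; upTo; foldr; [_])
open import Data.List.Relation.Unary.Any using (Any)
open import Relation.Binary.PropositionalEquality using (_≡_)
open import Relation.Nullary using (¬_)
open import Data.Product using (_×_)

-- Inversion sequences of length n: (a_1,...,a_n) with 0 ≤ a_i < i.
-- Built by appending a last entry a_n ∈ {0,...,n-1}.
invSeqs : ℕ → List (List ℕ)
invSeqs zero    = [] ∷ []
invSeqs (suc n) = concatMap (λ s → map (λ a → s ++ [ a ]) (upTo (suc n))) (invSeqs n)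

reduce : List ℕ → List ℕ
reduce s = map (λ x → length (filter (_<? x) (deduplicate ℕ._≟_ s))) s

subseqs : List ℕ → List (List ℕ)
subseqs []       = [] ∷ []
subseqs (x ∷ xs) = map (x ∷_) (subseqs xs) ++ subseqs xs

Contains : List ℕ → List ℕ → Set
Contains a σ = Any (λ s → reduce s ≡ σ) (subseqs a)

Avoids : List ℕ → List ℕ → Set
Avoids a σ = ¬ Contains a σ

p100 p102 p201 p210 : List ℕ
p100 = 1 ∷ 0 ∷ 0 ∷ []
p102 = 1 ∷ 0 ∷ 2 ∷ []
p201 = 2 ∷ 0 ∷ 1 ∷ []
p210 = 2 ∷ 1 ∷ 0 ∷ []

AvoidsAll : List ℕ → Set
AvoidsAll a = Avoids a p100 × Avoids a p102 × Avoids a p201 × Avoids a p210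

open import Relation.Nullary.Decidable using (¬?)
open import Data.List.Relation.Unary.Any using (any?)
open import Data.List.Properties using (≡-dec)
open import Relation.Nullary.Decidable using (_×-dec_)

avoidsAll? : (a : List ℕ) → Relation.Nullary.Dec (AvoidsAll a)
avoidsAll? a = av p100 ×-dec (av p102 ×-dec (av p201 ×-dec av p210))
  where
  av : (σ : List ℕ) → Relation.Nullary.Dec (Avoids a σ)
  av σ = ¬? (any? (λ s → ≡-dec ℕ._≟_ (reduce s) σ) (subseqs a))

I : ℕ → ℕ
I n = length (filter avoidsAll? (invSeqs n))

PS : Set
PS = ℕ → ℤ

sumℤ : List ℤ → ℤ
sumℤ = foldr _+ℤ_ (+ 0)

_⊛_ : PS → PS → PS
(f ⊛ g) n = sumℤ (map (λ k → f k *ℤ g (n ∸ k)) (upTo (suc n)))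
infixl 7 _⊛_

_⊝_ : PS → PS → PS
(f ⊝ g) n = f n -ℤ g n
infixl 6 _⊝_

poly : List ℤ → PS
poly []       n       = + 0
poly (c ∷ cs) zero    = c
poly (c ∷ cs) (suc n) = poly cs n

_≐_ : PS → PS → Set
f ≐ g = ∀ n → f n ≡ g n
infix 4 _≐_

F : PS
F n = + I n

-- Read from left to right, an avoider (no i < j < k with a_i > a_j and a_i ≠ a_k) is weakly
-- increasing up to its first descent; from then on every entry must equal the top of that
-- descent, and descents with two different tops admit no further entry.  A four-state
-- automaton therefore recognises avoiders, and summing weights of its states over all
-- one-entry extensions gives linear recurrences
--   I(n+1) = (n+1) C(n) + Z(n),   Z(n+1) = Z(n) + G(n),   G(n+1) = G(n) + C(n+2) - 2 C(n+1),
-- where C(n) counts weakly increasing inversion sequences (the Catalan numbers, read off the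
-- ballot table), Z(n) the avoiders whose descents exist and share one top, and G(n) the
-- one-entry extensions of weakly increasing sequences that create such a first descent.
-- With S = √(1-4z) = 1 - 2z Σ C(n) zⁿ and (n+2) C(n+1) = (4n+2) C(n), multiplying F by
-- 2(1-z)²(1-4z) turns these recurrences into the stated identity of power series.

module Submission where

open import Algebra.Bundles using (Semiring)
open import Function using (_∘_)

module Sums {c ℓ} (R : Semiring c ℓ) where
  open import Data.Nat using (ℕ; zero; suc; _+_; _∸_; _<_; z<s; s<s)
  open import Data.Nat.Properties using (+-∸-assoc; n∸n≡0; ≤-pred)
  open import Relation.Binary.PropositionalEquality using (cong)
  module R = Semiring R
  open R using (Carrier; _≈_; 0#)
  open import Data.List using (List; []; _∷_; _++_; map; concatMap; applyUpTo)
  open import Data.List.Relation.Unary.All using (All; []; _∷_)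
  open import Algebra.Properties.CommutativeSemigroup R.+-commutativeSemigroup using (interchange)
  open import Relation.Binary.Reasoning.Setoid R.setoid

  ∑< : ℕ → (ℕ → Carrier) → Carrier
  ∑< zero    f = 0#
  ∑< (suc n) f = f 0 R.+ ∑< n (f ∘ suc)
  syntax ∑< n (λ k → e) = ∑[ k < n ] e

  ∑-cong : ∀ n {f g : ℕ → Carrier} → (∀ k → k < n → f k ≈ g k) → ∑< n f ≈ ∑< n g
  ∑-cong zero    _   = R.refl
  ∑-cong (suc n) f≈g = R.+-cong (f≈g 0 z<s) (∑-cong n (λ k k<n → f≈g (suc k) (s<s k<n)))

  ∑-last : ∀ n f → ∑< (suc n) f ≈ ∑< n f R.+ f n
  ∑-last zero    f = R.+-comm (f 0) 0#
  ∑-last (suc n) f = begin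
    f 0 R.+ ∑< (suc n) (f ∘ suc)            ≈⟨ R.+-congˡ (∑-last n (f ∘ suc)) ⟩
    f 0 R.+ (∑< n (f ∘ suc) R.+ f (suc n))  ≈⟨ R.+-assoc (f 0) _ _ ⟨
    f 0 R.+ ∑< n (f ∘ suc) R.+ f (suc n)    ∎

  ∑-split : ∀ m n f → ∑< (m + n) f ≈ ∑< m f R.+ ∑< n (λ j → f (m + j))
  ∑-split zero    n f = R.sym (R.+-identityˡ _)
  ∑-split (suc m) n f = begin
    f 0 R.+ ∑< (m + n) (f ∘ suc)    ≈⟨ R.+-congˡ (∑-split m n (f ∘ suc)) ⟩
    f 0 R.+ (∑< m (f ∘ suc) R.+ _)  ≈⟨ R.+-assoc (f 0) _ _ ⟨
    f 0 R.+ ∑< m (f ∘ suc) R.+ _    ∎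

  ∑-distrib-+ : ∀ n f g → ∑< n (λ k → f k R.+ g k) ≈ ∑< n f R.+ ∑< n g
  ∑-distrib-+ zero    f g = R.sym (R.+-identityˡ 0#)
  ∑-distrib-+ (suc n) f g = begin
    f 0 R.+ g 0 R.+ ∑< n (λ k → f (suc k) R.+ g (suc k)) ≈⟨ R.+-congˡ (∑-distrib-+ n (f ∘ suc) (g ∘ suc)) ⟩
    f 0 R.+ g 0 R.+ (∑< n (f ∘ suc) R.+ ∑< n (g ∘ suc))  ≈⟨ interchange (f 0) (g 0) _ _ ⟩
    ∑< (suc n) f R.+ ∑< (suc n) g                        ∎

  ∑-distribˡ-* : ∀ n x f → ∑< n (λ k → x R.* f k) ≈ x R.* ∑< n f
  ∑-distribˡ-* zero    x f = R.sym (R.zeroʳ x)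
  ∑-distribˡ-* (suc n) x f = begin
    x R.* f 0 R.+ ∑< n (λ k → x R.* f (suc k)) ≈⟨ R.+-congˡ (∑-distribˡ-* n x (f ∘ suc)) ⟩
    x R.* f 0 R.+ x R.* ∑< n (f ∘ suc)         ≈⟨ R.distribˡ x (f 0) _ ⟨
    x R.* ∑< (suc n) f                         ∎

  ∑-zero : ∀ n → ∑< n (λ _ → 0#) ≈ 0#
  ∑-zero zero    = R.refl
  ∑-zero (suc n) = R.trans (R.+-identityˡ _) (∑-zero n)

  ∑-antidiagonal-last : ∀ (g : ℕ → ℕ → Carrier) y →
                        ∑< (suc (suc y)) (λ k → g k (suc y ∸ k))
                          ≈ ∑< (suc y) (λ k → g k (suc (y ∸ k))) R.+ g (suc y) 0
  ∑-antidiagonal-last g y = begin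
    ∑< (suc (suc y)) (λ k → g k (suc y ∸ k))
      ≈⟨ ∑-last (suc y) (λ k → g k (suc y ∸ k)) ⟩
    ∑< (suc y) (λ k → g k (suc y ∸ k)) R.+ g (suc y) (y ∸ y)
      ≈⟨ R.+-cong (∑-cong (suc y) (λ k k≤y → R.reflexive (cong (g k) (+-∸-assoc 1 (≤-pred k≤y)))))
                  (R.reflexive (cong (g (suc y)) (n∸n≡0 y))) ⟩
    ∑< (suc y) (λ k → g k (suc (y ∸ k))) R.+ g (suc y) 0
      ∎

  ∑ᴸ : ∀ {A : Set} → List A → (A → Carrier) → Carrier
  ∑ᴸ []       f = 0#
  ∑ᴸ (x ∷ xs) f = f x R.+ ∑ᴸ xs f
  syntax ∑ᴸ xs (λ x → e) = ∑[ x ← xs ] e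

  module _ {A : Set} where

    ∑ᴸ-cong : ∀ {xs : List A} {f g} → All (λ x → f x ≈ g x) xs → ∑ᴸ xs f ≈ ∑ᴸ xs g
    ∑ᴸ-cong []          = R.refl
    ∑ᴸ-cong (fx≈gx ∷ h) = R.+-cong fx≈gx (∑ᴸ-cong h)

    ∑ᴸ-++ : ∀ (xs ys : List A) f → ∑ᴸ (xs ++ ys) f ≈ ∑ᴸ xs f R.+ ∑ᴸ ys f
    ∑ᴸ-++ []       ys f = R.sym (R.+-identityˡ _)
    ∑ᴸ-++ (x ∷ xs) ys f = R.trans (R.+-congˡ (∑ᴸ-++ xs ys f)) (R.sym (R.+-assoc (f x) _ _))

    ∑ᴸ-concatMap : ∀ {B : Set} (h : B → List A) xs f → ∑ᴸ (concatMap h xs) f ≈ ∑ᴸ xs (λ y → ∑ᴸ (h y) f)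
    ∑ᴸ-concatMap h []       f = R.refl
    ∑ᴸ-concatMap h (y ∷ ys) f = R.trans (∑ᴸ-++ (h y) (concatMap h ys) f) (R.+-congˡ (∑ᴸ-concatMap h ys f))

    ∑ᴸ-map : ∀ {B : Set} (h : B → A) xs f → ∑ᴸ (map h xs) f ≈ ∑ᴸ xs (f ∘ h)
    ∑ᴸ-map h []       f = R.refl
    ∑ᴸ-map h (y ∷ ys) f = R.+-congˡ (∑ᴸ-map h ys f)

    ∑ᴸ-applyUpTo : ∀ (h : ℕ → A) n f → ∑ᴸ (applyUpTo h n) f ≈ ∑< n (f ∘ h)
    ∑ᴸ-applyUpTo h zero    f = R.refl
    ∑ᴸ-applyUpTo h (suc n) f = R.+-congˡ (∑ᴸ-applyUpTo (h ∘ suc) n f)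

    ∑ᴸ-distrib-+ : ∀ (xs : List A) f g → ∑ᴸ xs (λ x → f x R.+ g x) ≈ ∑ᴸ xs f R.+ ∑ᴸ xs g
    ∑ᴸ-distrib-+ []       f g = R.sym (R.+-identityˡ 0#)
    ∑ᴸ-distrib-+ (x ∷ xs) f g = R.trans (R.+-congˡ (∑ᴸ-distrib-+ xs f g)) (interchange (f x) (g x) _ _)

    ∑ᴸ-distribˡ-* : ∀ (xs : List A) y f → ∑ᴸ xs (λ x → y R.* f x) ≈ y R.* ∑ᴸ xs f
    ∑ᴸ-distribˡ-* []       y f = R.sym (R.zeroʳ y)
    ∑ᴸ-distribˡ-* (x ∷ xs) y f = R.trans (R.+-congˡ (∑ᴸ-distribˡ-* xs y f)) (R.sym (R.distribˡ y (f x) _))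

    ∑ᴸ-zero : ∀ (xs : List A) → ∑ᴸ xs (λ _ → 0#) ≈ 0#
    ∑ᴸ-zero []       = R.refl
    ∑ᴸ-zero (x ∷ xs) = R.trans (R.+-identityˡ _) (∑ᴸ-zero xs)

    ∑ᴸ-∑-comm : ∀ (xs : List A) n (h : A → ℕ → Carrier) →
                ∑ᴸ xs (λ x → ∑< n (h x)) ≈ ∑< n (λ k → ∑ᴸ xs (λ x → h x k))
    ∑ᴸ-∑-comm xs zero    h = ∑ᴸ-zero xs
    ∑ᴸ-∑-comm xs (suc n) h = R.trans (∑ᴸ-distrib-+ xs (λ x → h x 0) (λ x → ∑< n (h x ∘ suc)))
                                   (R.+-congˡ (∑ᴸ-∑-comm xs n (λ x → h x ∘ suc)))

module Enumeration where

  open import Defs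
  open import Data.Nat
  open import Data.Nat.Properties
  open import Data.Nat.Combinatorics using (_C_; nCk+nC[k+1]≡[n+1]C[k+1]; k>n⇒nCk≡0; nCk≡nC[n∸k]; nC1≡n)
  open import Data.Bool using (Bool; true; false; if_then_else_)
  open import Data.Unit using (⊤; tt)
  open import Data.List using (List; []; _∷_; [_]; _∷ʳ_; map; length; filter; deduplicate; foldl; upTo)
  open import Data.List.Properties using (∷ʳ-injective; length-map; filter-accept; filter-reject; foldl-∷ʳ)
  open import Data.List.Membership.Propositional using (_∈_; find; lose)
  open import Data.List.Relation.Binary.Sublist.Propositional using (⊆-refl)
  open import Data.List.Relation.Binary.Sublist.Propositional.Properties using (filter⁺; length-mono-≤)
  open import Data.List.Relation.Unary.All as All using (All; []; _∷_)
  import Data.List.Relation.Unary.All.Properties as All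
  open import Data.List.Relation.Unary.Any as Any using (Any; here; there; satisfied)
  open import Data.List.Relation.Unary.Any.Properties using (map⁺; map⁻; ++⁺ˡ; ++⁺ʳ; ++⁻; swap)
  open import Data.Sum as Sum using (_⊎_; inj₁; inj₂; [_,_]′)
  open import Data.Product using (_×_; _,_; proj₁; proj₂; ∃; ∃₂)
  open import Function using (_∘_; id)
  open import Relation.Binary.PropositionalEquality hiding ([_])
  open import Relation.Binary.Definitions using (tri<; tri≈; tri>)
  open import Relation.Nullary using (¬_; yes; no; contradiction)
  open import Relation.Nullary.Decidable using (dec-true; dec-false)
  open import Data.Nat.Tactic.RingSolver using (solve-∀)

  open Sums +-*-semiring

  ∑-const : ∀ n c → ∑[ k < n ] c ≡ n * c
  ∑-const zero    c = refl
  ∑-const (suc n) c = cong (c +_) (∑-const n c)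

  ∑-indicator : ∀ N b x → ∑[ a < N ] (if a ≡ᵇ b then x else 0) ≡ (if b <ᵇ N then x else 0)
  ∑-indicator zero    b       x = refl
  ∑-indicator (suc N) zero    x = trans (cong (x +_) (∑-zero N)) (+-identityʳ x)
  ∑-indicator (suc N) (suc b) x = ∑-indicator N b x

  ∑-threshold : ∀ {m M} (g : Bool → ℕ) → m ≤ M → ∑[ a < M ] g (a <ᵇ m) ≡ m * g true + (M ∸ m) * g false
  ∑-threshold {m} {M} g m≤M = begin
    ∑[ a < M ] g (a <ᵇ m)
      ≡⟨ cong (λ N → ∑< N (g ∘ (_<ᵇ m))) (sym (m+[n∸m]≡n m≤M)) ⟩
    ∑[ a < m + (M ∸ m) ] g (a <ᵇ m)
      ≡⟨ ∑-split m (M ∸ m) (g ∘ (_<ᵇ m)) ⟩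
    ∑[ a < m ] g (a <ᵇ m) + ∑[ j < M ∸ m ] g (m + j <ᵇ m)
      ≡⟨ cong₂ _+_ (∑-cong m (λ a a<m → cong g (dec-true (a <? m) a<m)))
                   (∑-cong (M ∸ m) (λ j _ → cong g (dec-false (m + j <? m) (≤⇒≯ (m≤m+n m j))))) ⟩
    ∑[ a < m ] g true + ∑[ j < M ∸ m ] g false
      ≡⟨ cong₂ _+_ (∑-const m (g true)) (∑-const (M ∸ m) (g false)) ⟩
    m * g true + (M ∸ m) * g false
      ∎
    where open ≡-Reasoning

  triangle : ℕ → ℕ
  triangle r = ∑[ j < r ] suc j

  ∑-countdown : ∀ r → ∑[ j < r ] (suc r ∸ j) ≡ triangle r + r
  ∑-countdown zero    = refl
  ∑-countdown (suc r) = begin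
    suc (suc r) + ∑[ j < r ] (suc r ∸ j) ≡⟨ cong (suc (suc r) +_) (∑-countdown r) ⟩
    suc (suc r) + (triangle r + r)       ≡⟨ regroup (triangle r) r ⟩
    triangle r + suc r + suc r           ≡⟨ cong (_+ suc r) (sym (∑-last r suc)) ⟩
    triangle (suc r) + suc r             ∎
    where
    open ≡-Reasoning
    regroup : ∀ t r → suc (suc r) + (t + r) ≡ t + suc r + suc r
    regroup = solve-∀

  suc[m+n]∸m≡suc[n] : ∀ m n → suc (m + n) ∸ m ≡ suc n
  suc[m+n]∸m≡suc[n] m n = trans (cong (_∸ m) (sym (+-suc m n))) (m+n∸m≡n m (suc n))

  Any-subseqs-∷ʳ⁻ : ∀ {P : List ℕ → Set} s a → Any P (subseqs (s ∷ʳ a)) →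
                    Any P (subseqs s) ⊎ Any (P ∘ (_∷ʳ a)) (subseqs s)
  Any-subseqs-∷ʳ⁻ [] a (here p)         = inj₂ (here p)
  Any-subseqs-∷ʳ⁻ [] a (there (here p)) = inj₁ (here p)
  Any-subseqs-∷ʳ⁻ (x ∷ s) a h with ++⁻ (map (x ∷_) (subseqs (s ∷ʳ a))) h
  ... | inj₁ p = Sum.map (++⁺ˡ ∘ map⁺) (++⁺ˡ ∘ map⁺) (Any-subseqs-∷ʳ⁻ s a (map⁻ p))
  ... | inj₂ p = Sum.map (++⁺ʳ _) (++⁺ʳ _) (Any-subseqs-∷ʳ⁻ s a p)

  Any-subseqs-∷ʳ⁺ : ∀ {P : List ℕ → Set} s a → Any P (subseqs s) ⊎ Any (P ∘ (_∷ʳ a)) (subseqs s) →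
                    Any P (subseqs (s ∷ʳ a))
  Any-subseqs-∷ʳ⁺ [] a (inj₁ (here p)) = there (here p)
  Any-subseqs-∷ʳ⁺ [] a (inj₂ (here p)) = here p
  Any-subseqs-∷ʳ⁺ (x ∷ s) a h with Sum.map (++⁻ (map (x ∷_) (subseqs s))) (++⁻ (map (x ∷_) (subseqs s))) h
  ... | inj₁ (inj₁ p) = ++⁺ˡ (map⁺ (Any-subseqs-∷ʳ⁺ s a (inj₁ (map⁻ p))))
  ... | inj₂ (inj₁ p) = ++⁺ˡ (map⁺ (Any-subseqs-∷ʳ⁺ s a (inj₂ (map⁻ p))))
  ... | inj₁ (inj₂ p) = ++⁺ʳ _ (Any-subseqs-∷ʳ⁺ s a (inj₁ p))
  ... | inj₂ (inj₂ p) = ++⁺ʳ _ (Any-subseqs-∷ʳ⁺ s a (inj₂ p))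

  []∈subseqs : ∀ s → [] ∈ subseqs s
  []∈subseqs []      = here refl
  []∈subseqs (x ∷ s) = ++⁺ʳ _ ([]∈subseqs s)

  ∈-subseqs-∷ʳ⁺ : ∀ {u} s a → u ∈ subseqs s → u ∈ subseqs (s ∷ʳ a)
  ∈-subseqs-∷ʳ⁺ s a p = Any-subseqs-∷ʳ⁺ s a (inj₁ p)

  ∷ʳ-∈-subseqs-∷ʳ : ∀ {u} s a → u ∈ subseqs s → u ∷ʳ a ∈ subseqs (s ∷ʳ a)
  ∷ʳ-∈-subseqs-∷ʳ s a p = Any-subseqs-∷ʳ⁺ s a (inj₂ (Any.map (cong (_∷ʳ a)) p))

  ∈-subseqs-∷ʳ⁻ : ∀ {u b} s a → u ∷ʳ b ∈ subseqs (s ∷ʳ a) →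
                  u ∷ʳ b ∈ subseqs s ⊎ (u ∈ subseqs s × b ≡ a)
  ∈-subseqs-∷ʳ⁻ {u} s a p with Any-subseqs-∷ʳ⁻ s a p
  ... | inj₁ q = inj₁ q
  ... | inj₂ q = inj₂ (Any.map (proj₁ ∘ ∷ʳ-injective u _) q , proj₂ (∷ʳ-injective u _ (proj₂ (satisfied q))))

  forbidden : List (List ℕ)
  forbidden = p100 ∷ p102 ∷ p201 ∷ p210 ∷ []

  rank : ℕ → List ℕ → ℕ
  rank v L = length (filter (_<? v) L)

  rank-mono : ∀ {x y} → x ≤ y → ∀ L → rank x L ≤ rank y L
  rank-mono {x} {y} x≤y L = length-mono-≤ (filter⁺ (_<? x) (_<? y) (λ { refl u<x → <-≤-trans u<x x≤y }) (⊆-refl {x = L}))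

  descent-of-forbidden : ∀ {a b c} → a ∷ b ∷ c ∷ [] ∈ forbidden → b < a × a ≢ c
  descent-of-forbidden (here refl)                         = s≤s z≤n , λ ()
  descent-of-forbidden (there (here refl))                 = s≤s z≤n , λ ()
  descent-of-forbidden (there (there (here refl)))         = s≤s z≤n , λ ()
  descent-of-forbidden (there (there (there (here refl)))) = s≤s (s≤s z≤n) , λ ()

  forbidden⇒descent : ∀ {x y z} → reduce (x ∷ y ∷ z ∷ []) ∈ forbidden → y < x × x ≢ z
  forbidden⇒descent {x} {y} {z} p with descent-of-forbidden p
  ... | ry<rx , rx≢rz = ≰⇒> (λ x≤y → <⇒≱ ry<rx (rank-mono x≤y (deduplicate _≟_ (x ∷ y ∷ z ∷ []))))
                      , λ { refl → rx≢rz refl }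

  module _ {x y : ℕ} (y<x : y < x) where

    -- Each rewrite decides one comparison made by `reduce`; they must come in evaluation order.

    reduce-100 : reduce (x ∷ y ∷ y ∷ []) ≡ p100
    reduce-100
      rewrite dec-false (x ≟ y) (>⇒≢ y<x) | dec-true (y ≟ y) refl
            | dec-false (x <? x) (<-irrefl refl) | dec-false (x <? y) (<⇒≯ y<x)
            | dec-true (y <? x) y<x | dec-false (y <? y) (<-irrefl refl) = refl

    reduce-201 : ∀ {z} → y < z → z < x → reduce (x ∷ y ∷ z ∷ []) ≡ p201
    reduce-201 {z} y<z z<x
      rewrite dec-false (y ≟ z) (<⇒≢ y<z) | dec-false (x ≟ y) (>⇒≢ y<x) | dec-false (x ≟ z) (>⇒≢ z<x)
            | dec-false (x <? x) (<-irrefl refl) | dec-false (x <? y) (<⇒≯ y<x) | dec-false (x <? z) (<⇒≯ z<x)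
            | dec-true (y <? x) y<x | dec-false (y <? y) (<-irrefl refl) | dec-true (y <? z) y<z
            | dec-true (z <? x) z<x | dec-false (z <? y) (<⇒≯ y<z) | dec-false (z <? z) (<-irrefl refl) = refl

    reduce-102 : ∀ {z} → x < z → reduce (x ∷ y ∷ z ∷ []) ≡ p102
    reduce-102 {z} x<z
      rewrite dec-false (y ≟ z) (<⇒≢ (<-trans y<x x<z)) | dec-false (x ≟ y) (>⇒≢ y<x) | dec-false (x ≟ z) (<⇒≢ x<z)
            | dec-false (x <? x) (<-irrefl refl) | dec-false (x <? y) (<⇒≯ y<x) | dec-true (x <? z) x<z
            | dec-true (y <? x) y<x | dec-false (y <? y) (<-irrefl refl) | dec-true (y <? z) (<-trans y<x x<z)
            | dec-false (z <? x) (<⇒≯ x<z) | dec-false (z <? y) (<⇒≯ (<-trans y<x x<z)) | dec-false (z <? z) (<-irrefl refl) = refl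

    reduce-210 : ∀ {z} → z < y → reduce (x ∷ y ∷ z ∷ []) ≡ p210
    reduce-210 {z} z<y
      rewrite dec-false (y ≟ z) (>⇒≢ z<y) | dec-false (x ≟ y) (>⇒≢ y<x) | dec-false (x ≟ z) (>⇒≢ (<-trans z<y y<x))
            | dec-false (x <? x) (<-irrefl refl) | dec-false (x <? y) (<⇒≯ y<x) | dec-false (x <? z) (<⇒≯ (<-trans z<y y<x))
            | dec-true (y <? x) y<x | dec-false (y <? y) (<-irrefl refl) | dec-false (y <? z) (<⇒≯ z<y)
            | dec-true (z <? x) (<-trans z<y y<x) | dec-true (z <? y) z<y | dec-false (z <? z) (<-irrefl refl) = refl

    descent⇒forbidden : ∀ {z} → x ≢ z → reduce (x ∷ y ∷ z ∷ []) ∈ forbidden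
    descent⇒forbidden {z} x≢z with <-cmp y z
    ... | tri≈ _ refl _ = here reduce-100
    ... | tri> _ _ z<y  = there (there (there (here (reduce-210 z<y))))
    ... | tri< y<z _ _ with <-cmp z x
    ...   | tri< z<x _ _  = there (there (here (reduce-201 y<z z<x)))
    ...   | tri≈ _ z≡x _  = contradiction (sym z≡x) x≢z
    ...   | tri> _ _ x<z  = there (here (reduce-102 x<z))

  forbidden-length : ∀ u → reduce u ∈ forbidden → length u ≡ 3
  forbidden-length u p = trans (sym (length-map _ u)) (All.lookup {P = λ σ → length σ ≡ 3} (refl ∷ refl ∷ refl ∷ refl ∷ []) p)

  forbidden-∷ʳ⇒descent : ∀ {a} t → reduce (t ∷ʳ a) ∈ forbidden →
                         ∃₂ λ x y → t ≡ x ∷ y ∷ [] × y < x × x ≢ a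
  forbidden-∷ʳ⇒descent {a} t p = go t (forbidden-length (t ∷ʳ a) p) p
    where
    go : ∀ t → length (t ∷ʳ a) ≡ 3 → reduce (t ∷ʳ a) ∈ forbidden →
         ∃₂ λ x y → t ≡ x ∷ y ∷ [] × y < x × x ≢ a
    go (x ∷ y ∷ []) _ p = x , y , refl , forbidden⇒descent p
    go []               ()
    go (_ ∷ [])         ()
    go (_ ∷ _ ∷ _ ∷ [])     ()
    go (_ ∷ _ ∷ _ ∷ _ ∷ _) ()

  Good : List ℕ → Set
  Good s = ¬ Any (λ u → reduce u ∈ forbidden) (subseqs s)

  good⇒avoidsAll : ∀ {s} → Good s → AvoidsAll s
  good⇒avoidsAll g = g ∘ swap ∘ here
                   , g ∘ swap ∘ there ∘ here
                   , g ∘ swap ∘ there ∘ there ∘ here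
                   , g ∘ swap ∘ there ∘ there ∘ there ∘ here

  avoidsAll⇒good : ∀ {s} → AvoidsAll s → Good s
  avoidsAll⇒good (a₁ , a₂ , a₃ , a₄) p with swap p
  ... | here c                         = a₁ c
  ... | there (here c)                 = a₂ c
  ... | there (there (here c))         = a₃ c
  ... | there (there (there (here c))) = a₄ c

  Descent : List ℕ → ℕ → Set
  Descent s x = ∃ λ y → x ∷ y ∷ [] ∈ subseqs s × y < x

  Completes : List ℕ → ℕ → Set
  Completes s a = ∃ λ x → Descent s x × x ≢ a

  good-∷ʳ : ∀ s a → Good s → ¬ Completes s a → Good (s ∷ʳ a)
  good-∷ʳ s a g ¬c p with Any-subseqs-∷ʳ⁻ s a p
  ... | inj₁ q = g q
  ... | inj₂ q with find q
  ...   | t , t∈ , r with forbidden-∷ʳ⇒descent t r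
  ...     | x , y , refl , y<x , x≢a = ¬c (x , (y , t∈ , y<x) , x≢a)

  good-∷ʳ⁻ : ∀ s a → Good (s ∷ʳ a) → Good s
  good-∷ʳ⁻ s a g = g ∘ Any-subseqs-∷ʳ⁺ s a ∘ inj₁

  completes⇒¬good : ∀ s a → Completes s a → ¬ Good (s ∷ʳ a)
  completes⇒¬good s a (x , (y , p , y<x) , x≢a) g =
    g (lose (∷ʳ-∈-subseqs-∷ʳ s a p) (descent⇒forbidden y<x x≢a))

  Descent-∷ʳ⁻ : ∀ s a {x} → Descent (s ∷ʳ a) x → Descent s x ⊎ ([ x ] ∈ subseqs s × a < x)
  Descent-∷ʳ⁻ s a {x} (y , p , y<x) with ∈-subseqs-∷ʳ⁻ {u = [ x ]} s a p
  ... | inj₁ q            = inj₁ (y , q , y<x)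
  ... | inj₂ (q , refl)   = inj₂ (q , y<x)

  Descent-∷ʳ⁺ : ∀ s a {x} → Descent s x → Descent (s ∷ʳ a) x
  Descent-∷ʳ⁺ s a (y , p , y<x) = y , ∈-subseqs-∷ʳ⁺ s a p , y<x

  new-Descent : ∀ s {a x} → [ x ] ∈ subseqs s → a < x → Descent (s ∷ʳ a) x
  new-Descent s {a} p a<x = a , ∷ʳ-∈-subseqs-∷ʳ s a p , a<x

  singleton-∈-subseqs-∷ʳ⁻ : ∀ s a {x} → [ x ] ∈ subseqs (s ∷ʳ a) → [ x ] ∈ subseqs s ⊎ x ≡ a
  singleton-∈-subseqs-∷ʳ⁻ s a p = Sum.map₂ proj₂ (∈-subseqs-∷ʳ⁻ {u = []} s a p)

  last-∈-subseqs : ∀ s a → [ a ] ∈ subseqs (s ∷ʳ a)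
  last-∈-subseqs s a = ∷ʳ-∈-subseqs-∷ʳ s a ([]∈subseqs s)

  -- An automaton recognising avoiders

  -- rising M m : weakly increasing so far, largest entry M, largest entry below M is m (or 0);
  -- frozen V   : every descent has top V, so each further entry must be V;
  -- closed     : descents with two different tops, so no entry can follow;
  -- failed     : a forbidden triple occurs.
  data State : Set where
    rising : (top below : ℕ) → State
    frozen : (top : ℕ) → State
    closed : State
    failed : State

  step : State → ℕ → State
  step (rising M m) a = if a <ᵇ m then closed else if a <ᵇ M then frozen M
                        else if M <ᵇ a then rising a M else rising M m
  step (frozen V)   a = if a ≡ᵇ V then frozen V else failed
  step closed       _ = failed
  step failed       _ = failed

  run : List ℕ → State
  run = foldl step (rising 0 0)

  run-∷ʳ : ∀ s a → run (s ∷ʳ a) ≡ step (run s) a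
  run-∷ʳ s a = foldl-∷ʳ step (rising 0 0) a s

  record RisingInv (s : List ℕ) (M m : ℕ) : Set where
    field
      good      : Good s
      ascending : ∀ {x} → ¬ Descent s x
      ≤top      : ∀ {x} → [ x ] ∈ subseqs s → x ≤ M
      ≤below    : ∀ {x} → [ x ] ∈ subseqs s → x < M → x ≤ m
      top∈      : [ M ] ∈ subseqs s ⊎ M ≡ 0
      below∈    : [ m ] ∈ subseqs s ⊎ m ≡ 0
      below<top : m < M ⊎ m ≡ 0 × M ≡ 0

  record FrozenInv (s : List ℕ) (V : ℕ) : Set where
    field
      good        : Good s
      ≤top        : ∀ {x} → [ x ] ∈ subseqs s → x ≤ V
      descent     : Descent s V
      descent-top : ∀ {x} → Descent s x → x ≡ V

  Inv : List ℕ → State → Set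
  Inv s (rising M m) = RisingInv s M m
  Inv s (frozen V)   = FrozenInv s V
  Inv s closed       = Good s × ∃₂ λ x x′ → Descent s x × Descent s x′ × x ≢ x′
  Inv s failed       = ¬ Good s

  Inv-[] : Inv [] (rising 0 0)
  Inv-[] = record
    { good      = λ { (here p) → contradiction (forbidden-length [] p) λ () ; (there ()) }
    ; ascending = λ { (_ , here () , _) ; (_ , there () , _) }
    ; ≤top      = λ { (here ()) ; (there ()) }
    ; ≤below    = λ _ ()
    ; top∈      = inj₂ refl
    ; below∈    = inj₂ refl
    ; below<top = inj₂ (refl , refl)
    }

  bounded-∷ʳ : ∀ s a {B} → (∀ {x} → [ x ] ∈ subseqs s → x ≤ B) → a ≤ B →
               ∀ {x} → [ x ] ∈ subseqs (s ∷ʳ a) → x ≤ B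
  bounded-∷ʳ s a ≤B a≤B x∈ = [ ≤B , (λ { refl → a≤B }) ]′ (singleton-∈-subseqs-∷ʳ⁻ s a x∈)

  occurs-if-positive : ∀ s {v a} → [ v ] ∈ subseqs s ⊎ v ≡ 0 → a < v → [ v ] ∈ subseqs s
  occurs-if-positive s (inj₁ p)    _ = p
  occurs-if-positive s (inj₂ refl) ()

  module RisingStep {s M m} (inv : RisingInv s M m) (a : ℕ) where
    open RisingInv inv

    good′ : Good (s ∷ʳ a)
    good′ = good-∷ʳ s a good (λ (_ , d , _) → ascending d)

    lift∈ : ∀ {v} → [ v ] ∈ subseqs s ⊎ v ≡ 0 → [ v ] ∈ subseqs (s ∷ʳ a) ⊎ v ≡ 0
    lift∈ = Sum.map₁ (∈-subseqs-∷ʳ⁺ s a)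

    no-new-descent : M ≤ a → ∀ {x} → ¬ Descent (s ∷ʳ a) x
    no-new-descent M≤a d with Descent-∷ʳ⁻ s a d
    ... | inj₁ d′         = ascending d′
    ... | inj₂ (x∈ , a<x) = <⇒≱ a<x (≤-trans (≤top x∈) M≤a)

    closes : a < m → Inv (s ∷ʳ a) closed
    closes a<m = good′ , m , M , new-Descent s (occurs-if-positive s below∈ a<m) a<m
                              , new-Descent s (occurs-if-positive s top∈ a<M) a<M , <⇒≢ m<M
      where
      m<M : m < M
      m<M with below<top
      ... | inj₁ m<M         = m<M
      ... | inj₂ (refl , _)  = contradiction a<m λ ()
      a<M = <-trans a<m m<M

    freezes : m ≤ a → a < M → FrozenInv (s ∷ʳ a) M
    freezes m≤a a<M = record
      { good        = good′
      ; ≤top        = bounded-∷ʳ s a ≤top (<⇒≤ a<M)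
      ; descent     = new-Descent s (occurs-if-positive s top∈ a<M) a<M
      ; descent-top = top
      }
      where
      top : ∀ {x} → Descent (s ∷ʳ a) x → x ≡ M
      top d with Descent-∷ʳ⁻ s a d
      ... | inj₁ d′ = contradiction d′ ascending
      ... | inj₂ (x∈ , a<x) with <-cmp _ M
      ...   | tri< x<M _ _ = contradiction (≤-trans (≤below x∈ x<M) m≤a) (<⇒≱ a<x)
      ...   | tri≈ _ x≡M _ = x≡M
      ...   | tri> _ _ x>M = contradiction (≤top x∈) (<⇒≱ x>M)

    raises : M < a → RisingInv (s ∷ʳ a) a M
    raises M<a = record
      { good      = good′
      ; ascending = no-new-descent (<⇒≤ M<a)
      ; ≤top      = bounded-∷ʳ s a (λ x∈ → ≤-trans (≤top x∈) (<⇒≤ M<a)) ≤-refl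
      ; ≤below    = λ x∈ x<a → [ ≤top , (λ { refl → contradiction x<a (<-irrefl refl) }) ]′
                                 (singleton-∈-subseqs-∷ʳ⁻ s a x∈)
      ; top∈      = inj₁ (last-∈-subseqs s a)
      ; below∈    = lift∈ top∈
      ; below<top = inj₁ M<a
      }

    repeats : a ≡ M → RisingInv (s ∷ʳ a) M m
    repeats refl = record
      { good      = good′
      ; ascending = no-new-descent ≤-refl
      ; ≤top      = bounded-∷ʳ s a ≤top ≤-refl
      ; ≤below    = λ x∈ x<M → [ (λ x∈ → ≤below x∈ x<M) , (λ { refl → contradiction x<M (<-irrefl refl) }) ]′
                                 (singleton-∈-subseqs-∷ʳ⁻ s a x∈)
      ; top∈      = lift∈ top∈
      ; below∈    = lift∈ below∈
      ; below<top = below<top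
      }

  rising-step : ∀ {s M m} a → RisingInv s M m → Inv (s ∷ʳ a) (step (rising M m) a)
  rising-step {M = M} {m} a inv with a <? m | a <? M | M <? a
  ... | yes a<m | _       | _
    rewrite dec-true (a <? m) a<m = closes a<m
    where open RisingStep inv a
  ... | no a≮m  | yes a<M | _
    rewrite dec-false (a <? m) a≮m | dec-true (a <? M) a<M = freezes (≮⇒≥ a≮m) a<M
    where open RisingStep inv a
  ... | no a≮m  | no a≮M  | yes M<a
    rewrite dec-false (a <? m) a≮m | dec-false (a <? M) a≮M | dec-true (M <? a) M<a = raises M<a
    where open RisingStep inv a
  ... | no a≮m  | no a≮M  | no M≮a
    rewrite dec-false (a <? m) a≮m | dec-false (a <? M) a≮M | dec-false (M <? a) M≮a
    = repeats (≤-antisym (≮⇒≥ M≮a) (≮⇒≥ a≮M))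
    where open RisingStep inv a

  frozen-step : ∀ {s V} a → FrozenInv s V → Inv (s ∷ʳ a) (step (frozen V) a)
  frozen-step {s} {V} a inv with a ≟ V
  ... | yes refl rewrite dec-true (a ≟ a) refl = record
    { good        = good-∷ʳ s a good (λ (_ , d , x≢a) → x≢a (descent-top d))
    ; ≤top        = bounded-∷ʳ s a ≤top ≤-refl
    ; descent     = Descent-∷ʳ⁺ s a descent
    ; descent-top = λ d → [ descent-top , (λ (x∈ , a<x) → contradiction (≤top x∈) (<⇒≱ a<x)) ]′
                            (Descent-∷ʳ⁻ s a d)
    }
    where open FrozenInv inv
  ... | no a≢V rewrite dec-false (a ≟ V) a≢V =
    completes⇒¬good s a (V , FrozenInv.descent inv , a≢V ∘ sym)

  Inv-step : ∀ s σ a → Inv s σ → Inv (s ∷ʳ a) (step σ a)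
  Inv-step s (rising M m) a inv = rising-step a inv
  Inv-step s (frozen V)   a inv = frozen-step a inv
  Inv-step s closed       a (_ , x , x′ , d , d′ , x≢x′) with x ≟ a
  ... | yes refl = completes⇒¬good s a (x′ , d′ , x≢x′ ∘ sym)
  ... | no x≢a   = completes⇒¬good s a (x , d , x≢a)
  Inv-step s failed       a ¬g = ¬g ∘ good-∷ʳ⁻ s a

  Bounded : ℕ → State → Set
  Bounded n (rising M m) = M ≤ n × m ≤ M
  Bounded n (frozen V)   = V ≤ n
  Bounded n closed       = ⊤
  Bounded n failed       = ⊤

  step-below : ∀ {M m a} → a < M → step (rising M m) a ≡ (if a <ᵇ m then closed else frozen M)
  step-below {M} {m} {a} a<M with a <ᵇ m
  ... | true  = refl
  ... | false rewrite dec-true (a <? M) a<M = refl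

  step-top : ∀ {M m} → m ≤ M → step (rising M m) M ≡ rising M m
  step-top {M} {m} m≤M rewrite dec-false (M <? m) (≤⇒≯ m≤M) | dec-false (M <? M) (<-irrefl refl) = refl

  step-above : ∀ {M m a} → m ≤ M → M < a → step (rising M m) a ≡ rising a M
  step-above {M} {m} {a} m≤M M<a
    rewrite dec-false (a <? m) (<⇒≯ (≤-<-trans m≤M M<a)) | dec-false (a <? M) (<⇒≯ M<a) | dec-true (M <? a) M<a = refl

  Bounded-step : ∀ {n} σ a → Bounded n σ → a ≤ n → Bounded (suc n) (step σ a)
  Bounded-step (rising M m) a (M≤n , m≤M) a≤n with <-cmp a M
  ... | tri< a<M _ _ rewrite step-below {m = m} a<M with a <ᵇ m
  ...   | true  = tt
  ...   | false = m≤n⇒m≤1+n M≤n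
  Bounded-step (rising M m) a (M≤n , m≤M) a≤n | tri≈ _ refl _ rewrite step-top m≤M = m≤n⇒m≤1+n M≤n , m≤M
  Bounded-step (rising M m) a (M≤n , m≤M) a≤n | tri> _ _ M<a rewrite step-above m≤M M<a = m≤n⇒m≤1+n a≤n , <⇒≤ M<a
  Bounded-step (frozen V) a V≤n _ with a ≟ V
  ... | yes refl rewrite dec-true (a ≟ a) refl = m≤n⇒m≤1+n V≤n
  ... | no a≢V   rewrite dec-false (a ≟ V) a≢V = tt
  Bounded-step closed _ _ _ = tt
  Bounded-step failed _ _ _ = tt

  All-invSeqs : (P : ℕ → List ℕ → Set) → P 0 [] → (∀ {n s a} → P n s → a ≤ n → P (suc n) (s ∷ʳ a)) →
                ∀ n → All (P n) (invSeqs n)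
  All-invSeqs P P[] P∷ʳ zero    = P[] ∷ []
  All-invSeqs P P[] P∷ʳ (suc n) = All.concat⁺ (All.map⁺ (All.map extend (All-invSeqs P P[] P∷ʳ n)))
    where
    extend : ∀ {s} → P n s → All (P (suc n)) (map (s ∷ʳ_) (upTo (suc n)))
    extend Ps = All.map⁺ (All.applyUpTo⁺₁ _ (suc n) (λ a<1+n → P∷ʳ Ps (≤-pred a<1+n)))

  Reachable : ℕ → List ℕ → Set
  Reachable n s = Inv s (run s) × Bounded n (run s)

  all-reachable : ∀ n → All (Reachable n) (invSeqs n)
  all-reachable = All-invSeqs Reachable (Inv-[] , z≤n , z≤n) extend
    where
    extend : ∀ {n s a} → Reachable n s → a ≤ n → Reachable (suc n) (s ∷ʳ a)
    extend {s = s} {a} (inv , bnd) a≤n rewrite run-∷ʳ s a = Inv-step s (run s) a inv , Bounded-step (run s) a bnd a≤n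

  total : (State → ℕ) → ℕ → ℕ
  total w n = ∑[ s ← invSeqs n ] w (run s)

  ∑-invSeqs-suc : ∀ n (g : List ℕ → ℕ) →
                  ∑[ s ← invSeqs (suc n) ] g s ≡ ∑[ s ← invSeqs n ] ∑[ a < suc n ] g (s ∷ʳ a)
  ∑-invSeqs-suc n g = trans (∑ᴸ-concatMap extensions (invSeqs n) g) (∑ᴸ-cong (All.universal by-last (invSeqs n)))
    where
    extensions : List ℕ → List (List ℕ)
    extensions s = map (s ∷ʳ_) (upTo (suc n))
    by-last : ∀ s → ∑ᴸ (extensions s) g ≡ ∑[ a < suc n ] g (s ∷ʳ a)
    by-last s = trans (∑ᴸ-map (s ∷ʳ_) (upTo (suc n)) g) (∑ᴸ-applyUpTo id (suc n) (g ∘ (s ∷ʳ_)))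

  transfer : ∀ n (g h : State → ℕ) → (∀ σ → Bounded n σ → ∑[ a < suc n ] g (step σ a) ≡ h σ) →
             total g (suc n) ≡ total h n
  transfer n g h g→h = trans (∑-invSeqs-suc n (g ∘ run)) (∑ᴸ-cong (All.map extend (all-reachable n)))
    where
    extend : ∀ {s} → Reachable n s → ∑[ a < suc n ] g (run (s ∷ʳ a)) ≡ h (run s)
    extend {s} (_ , bnd) = trans (∑-cong (suc n) (λ a _ → cong g (run-∷ʳ s a))) (g→h (run s) bnd)

  alive : State → ℕ
  alive failed = 0
  alive _      = 1

  alive-good : ∀ {s} σ → Inv s σ → Good s → alive σ ≡ 1
  alive-good (rising _ _) _  _ = refl
  alive-good (frozen _)   _  _ = refl
  alive-good closed       _  _ = refl
  alive-good failed       ¬g g = contradiction g ¬g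

  alive-¬good : ∀ {s} σ → Inv s σ → ¬ Good s → alive σ ≡ 0
  alive-¬good (rising _ _) inv      ¬g = contradiction (RisingInv.good inv) ¬g
  alive-¬good (frozen _)   inv      ¬g = contradiction (FrozenInv.good inv) ¬g
  alive-¬good closed       (g , _)  ¬g = contradiction g ¬g
  alive-¬good failed       _        _  = refl

  I≡total-alive : ∀ n → I n ≡ total alive n
  I≡total-alive n = count (invSeqs n) (All.map proj₁ (all-reachable n))
    where
    count : ∀ xs → All (λ s → Inv s (run s)) xs → length (filter avoidsAll? xs) ≡ ∑[ s ← xs ] alive (run s)
    count []       []           = refl
    count (s ∷ xs) (inv ∷ invs) with avoidsAll? s
    ... | yes av = trans (cong length (filter-accept avoidsAll? {x = s} {xs = xs} av))
                         (cong₂ _+_ (sym (alive-good (run s) inv (avoidsAll⇒good {s} av))) (count xs invs))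
    ... | no ¬av = trans (cong length (filter-reject avoidsAll? {x = s} {xs = xs} ¬av))
                         (cong₂ _+_ (sym (alive-¬good (run s) inv (¬av ∘ good⇒avoidsAll {s}))) (count xs invs))

  ∑-step-rising : ∀ (f : State → ℕ) {M m} r → m ≤ M →
                  ∑[ a < suc (M + r) ] f (step (rising M m) a)
                    ≡ m * f closed + (M ∸ m) * f (frozen M) + (f (rising M m) + ∑[ j < r ] f (rising (M + suc j) M))
  ∑-step-rising f {M} {m} r m≤M = begin
    ∑[ a < suc (M + r) ] g a                                  ≡⟨ cong (λ N → ∑< N g) (sym (+-suc M r)) ⟩
    ∑[ a < M + suc r ] g a                                    ≡⟨ ∑-split M (suc r) g ⟩
    ∑[ a < M ] g a + (g (M + 0) + ∑[ j < r ] g (M + suc j))   ≡⟨ cong₂ _+_ below (cong₂ _+_ top above) ⟩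
    m * f closed + (M ∸ m) * f (frozen M) + (f (rising M m) + ∑[ j < r ] f (rising (M + suc j) M)) ∎
    where
    open ≡-Reasoning
    g : ℕ → ℕ
    g a = f (step (rising M m) a)
    below : ∑[ a < M ] g a ≡ m * f closed + (M ∸ m) * f (frozen M)
    below = trans (∑-cong M (λ a a<M → cong f (step-below {m = m} a<M)))
                  (∑-threshold (λ b → f (if b then closed else frozen M)) m≤M)
    top : g (M + 0) ≡ f (rising M m)
    top = cong f (trans (cong (step (rising M m)) (+-identityʳ M)) (step-top m≤M))
    above : ∑[ j < r ] g (M + suc j) ≡ ∑[ j < r ] f (rising (M + suc j) M)
    above = ∑-cong r (λ j _ → cong f (step-above m≤M (m<m+n M z<s)))

  ∑-step-frozen : ∀ (f : State → ℕ) {V} n → f failed ≡ 0 → V ≤ n →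
                  ∑[ a < suc n ] f (step (frozen V) a) ≡ f (frozen V)
  ∑-step-frozen f {V} n f-failed V≤n = begin
    ∑[ a < suc n ] f (step (frozen V) a)                   ≡⟨ ∑-cong (suc n) (λ a _ → indicator a) ⟩
    ∑[ a < suc n ] (if a ≡ᵇ V then f (frozen V) else 0)    ≡⟨ ∑-indicator (suc n) V (f (frozen V)) ⟩
    (if V <ᵇ suc n then f (frozen V) else 0)               ≡⟨ cong (if_then f (frozen V) else 0) (dec-true (V <? suc n) (s≤s V≤n)) ⟩
    f (frozen V)                                           ∎
    where
    open ≡-Reasoning
    indicator : ∀ a → f (step (frozen V) a) ≡ (if a ≡ᵇ V then f (frozen V) else 0)
    indicator a with a ≡ᵇ V
    ... | true  = refl
    ... | false = f-failed

  ∑-step-failed : ∀ (f : State → ℕ) n → f failed ≡ 0 → ∑[ a < suc n ] f failed ≡ 0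
  ∑-step-failed f n f-failed = trans (∑-cong (suc n) (λ _ _ → f-failed)) (∑-zero (suc n))

  risingWeight : (ℕ → ℕ → ℕ) → State → ℕ
  risingWeight w (rising M m) = w M m
  risingWeight w _            = 0

  isRising : State → ℕ
  isRising = risingWeight λ _ _ → 1

  isFrozen : State → ℕ
  isFrozen (frozen _) = 1
  isFrozen _          = 0

  gapWidth : State → ℕ
  gapWidth = risingWeight λ M m → M ∸ m

  -- For a rising state, headroom n counts the entries a ≤ n that keep it rising,
  -- and slack n adds up the gaps a − M that they open.
  headroom : ℕ → State → ℕ
  headroom n = risingWeight λ M _ → suc n ∸ M

  slack : ℕ → State → ℕ
  slack n = risingWeight λ M _ → triangle (n ∸ M)

  risingAt : ℕ → State → ℕ
  risingAt b = risingWeight λ M _ → if b ≡ᵇ M then 1 else 0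

  ∑-step-risingWeight : ∀ w {M m} r → m ≤ M →
                        ∑[ a < suc (M + r) ] risingWeight w (step (rising M m) a) ≡ w M m + ∑[ j < r ] w (M + suc j) M
  ∑-step-risingWeight w {M} {m} r m≤M =
    trans (∑-step-rising (risingWeight w) r m≤M) (cong₂ (λ x y → x + y + rest) (*-zeroʳ m) (*-zeroʳ (M ∸ m)))
    where
    rest = w M m + ∑[ j < r ] w (M + suc j) M

  alive-transfer : ∀ n σ → Bounded n σ → ∑[ a < suc n ] alive (step σ a) ≡ isRising σ * suc n + isFrozen σ
  alive-transfer n (rising M m) (M≤n , m≤M) with m≤n⇒∃[o]m+o≡n M≤n
  ... | r , refl = begin
    _                                         ≡⟨ ∑-step-rising alive r m≤M ⟩
    m * 1 + (M ∸ m) * 1 + (1 + ∑[ j < r ] 1)  ≡⟨ cong₂ (λ x y → x + suc y) below above ⟩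
    M + suc r                                 ≡⟨ +-suc M r ⟩
    suc (M + r)                               ≡⟨ sym (trans (+-identityʳ _) (*-identityˡ _)) ⟩
    1 * suc (M + r) + 0                       ∎
    where
    open ≡-Reasoning
    below : m * 1 + (M ∸ m) * 1 ≡ M
    below = trans (cong₂ _+_ (*-identityʳ m) (*-identityʳ (M ∸ m))) (m+[n∸m]≡n m≤M)
    above : ∑[ j < r ] 1 ≡ r
    above = trans (∑-const r 1) (*-identityʳ r)
  alive-transfer n (frozen V) V≤n = ∑-step-frozen alive n refl V≤n
  alive-transfer n closed     _   = ∑-step-failed alive n refl
  alive-transfer n failed     _   = ∑-step-failed alive n refl

  isFrozen-transfer : ∀ n σ → Bounded n σ → ∑[ a < suc n ] isFrozen (step σ a) ≡ isFrozen σ + gapWidth σ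
  isFrozen-transfer n (rising M m) (M≤n , m≤M) with m≤n⇒∃[o]m+o≡n M≤n
  ... | r , refl = begin
    _                                             ≡⟨ ∑-step-rising isFrozen r m≤M ⟩
    m * 0 + (M ∸ m) * 1 + ∑[ j < r ] 0            ≡⟨ cong₂ (λ x y → x + (M ∸ m) * 1 + y) (*-zeroʳ m) (∑-zero r) ⟩
    (M ∸ m) * 1 + 0                               ≡⟨ trans (+-identityʳ _) (*-identityʳ _) ⟩
    M ∸ m                                         ∎
    where open ≡-Reasoning
  isFrozen-transfer n (frozen V) V≤n = trans (∑-step-frozen isFrozen n refl V≤n) (sym (+-identityʳ 1))
  isFrozen-transfer n closed     _   = ∑-step-failed isFrozen n refl
  isFrozen-transfer n failed     _   = ∑-step-failed isFrozen n refl

  gapWidth-transfer : ∀ n σ → Bounded n σ → ∑[ a < suc n ] gapWidth (step σ a) ≡ gapWidth σ + slack n σ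
  gapWidth-transfer n (rising M m) (M≤n , m≤M) with m≤n⇒∃[o]m+o≡n M≤n
  ... | r , refl = begin
    _                                                           ≡⟨ ∑-step-risingWeight (λ M m → M ∸ m) r m≤M ⟩
    M ∸ m + ∑[ j < r ] (M + suc j ∸ M)                          ≡⟨ cong (M ∸ m +_) (∑-cong r (λ j _ → m+n∸m≡n M (suc j))) ⟩
    M ∸ m + triangle r                                          ≡⟨ cong (λ x → M ∸ m + triangle x) (sym (m+n∸m≡n M r)) ⟩
    M ∸ m + triangle (M + r ∸ M)                                ∎
    where open ≡-Reasoning
  gapWidth-transfer n (frozen V) V≤n = ∑-step-frozen gapWidth n refl V≤n
  gapWidth-transfer n closed     _   = ∑-step-failed gapWidth n refl
  gapWidth-transfer n failed     _   = ∑-step-failed gapWidth n refl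

  isRising-transfer : ∀ n σ → Bounded n σ → ∑[ a < suc n ] isRising (step σ a) ≡ headroom n σ
  isRising-transfer n (rising M m) (M≤n , m≤M) with m≤n⇒∃[o]m+o≡n M≤n
  ... | r , refl = begin
    _                                                           ≡⟨ ∑-step-risingWeight (λ _ _ → 1) r m≤M ⟩
    suc (∑[ j < r ] 1)                                          ≡⟨ cong suc (trans (∑-const r 1) (*-identityʳ r)) ⟩
    suc r                                                       ≡⟨ sym (suc[m+n]∸m≡suc[n] M r) ⟩
    suc (M + r) ∸ M                                             ∎
    where open ≡-Reasoning
  isRising-transfer n (frozen V) V≤n = ∑-step-frozen isRising n refl V≤n
  isRising-transfer n closed     _   = ∑-step-failed isRising n refl
  isRising-transfer n failed     _   = ∑-step-failed isRising n refl

  headroom-transfer : ∀ n σ → Bounded n σ → ∑[ a < suc n ] headroom (suc n) (step σ a) ≡ slack n σ + 2 * headroom n σ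
  headroom-transfer n (rising M m) (M≤n , m≤M) with m≤n⇒∃[o]m+o≡n M≤n
  ... | r , refl = begin
    _
      ≡⟨ ∑-step-risingWeight (λ M′ _ → suc (suc (M + r)) ∸ M′) r m≤M ⟩
    suc (suc (M + r)) ∸ M + ∑[ j < r ] (suc (suc (M + r)) ∸ (M + suc j))
      ≡⟨ cong₂ _+_ top (∑-cong r (λ j _ → shift j)) ⟩
    suc (suc r) + ∑[ j < r ] (suc r ∸ j)
      ≡⟨ cong (suc (suc r) +_) (∑-countdown r) ⟩
    suc (suc r) + (triangle r + r)
      ≡⟨ regroup (triangle r) r ⟩
    triangle r + 2 * suc r
      ≡⟨ cong₂ (λ x y → triangle x + 2 * y) (sym (m+n∸m≡n M r)) (sym (suc[m+n]∸m≡suc[n] M r)) ⟩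
    triangle (M + r ∸ M) + 2 * (suc (M + r) ∸ M)
      ∎
    where
    open ≡-Reasoning
    top : suc (suc (M + r)) ∸ M ≡ suc (suc r)
    top = trans (cong (λ x → suc x ∸ M) (sym (+-suc M r))) (suc[m+n]∸m≡suc[n] M (suc r))
    shift : ∀ j → suc (suc (M + r)) ∸ (M + suc j) ≡ suc r ∸ j
    shift j = trans (cong (_∸ (M + suc j)) (sym (trans (+-suc M (suc r)) (cong suc (+-suc M r)))))
                    ([m+n]∸[m+o]≡n∸o M (suc (suc r)) (suc j))
    regroup : ∀ t r → suc (suc r) + (t + r) ≡ t + 2 * suc r
    regroup = solve-∀
  headroom-transfer n (frozen V) V≤n = ∑-step-frozen (headroom (suc n)) n refl V≤n
  headroom-transfer n closed     _   = ∑-step-failed (headroom (suc n)) n refl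
  headroom-transfer n failed     _   = ∑-step-failed (headroom (suc n)) n refl

  risingWeight-below : ∀ w {M m a} → a < M → risingWeight w (step (rising M m) a) ≡ 0
  risingWeight-below w {M} {m} {a} a<M rewrite step-below {m = m} a<M with a <ᵇ m
  ... | true  = refl
  ... | false = refl

  step-rising-at-least : ∀ {M m a} → m ≤ M → M ≤ a → ∃ λ m′ → step (rising M m) a ≡ rising a m′
  step-rising-at-least {M} {m} {a} m≤M M≤a with m≤n⇒m<n∨m≡n M≤a
  ... | inj₁ M<a  = M , step-above m≤M M<a
  ... | inj₂ refl = m , step-top m≤M

  risingAt-step : ∀ b {M m} a → m ≤ M →
                  risingAt b (step (rising M m) a) ≡ (if a ≡ᵇ b then (if M <ᵇ suc b then 1 else 0) else 0)
  risingAt-step b {M} {m} a m≤M with M ≤? a | a ≟ b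
  ... | no M≰a  | yes refl rewrite dec-true (a ≟ a) refl | dec-false (M <? suc a) (M≰a ∘ ≤-pred) =
    risingWeight-below (λ M′ _ → if b ≡ᵇ M′ then 1 else 0) {m = m} (≰⇒> M≰a)
  ... | no M≰a  | no a≢b   rewrite dec-false (a ≟ b) a≢b =
    risingWeight-below (λ M′ _ → if b ≡ᵇ M′ then 1 else 0) {m = m} (≰⇒> M≰a)
  ... | yes M≤a | a≟b with step-rising-at-least {m = m} m≤M M≤a
  ...   | m′ , eq rewrite eq with a≟b
  ...     | yes refl rewrite dec-true (a ≟ a) refl | dec-true (M <? suc a) (s≤s M≤a) = refl
  ...     | no a≢b   rewrite dec-false (a ≟ b) a≢b | dec-false (b ≟ a) (a≢b ∘ sym) = refl

  nothing-reached : ∀ n b → (if b <ᵇ suc n then ∑[ b′ < suc b ] 0 else 0) ≡ 0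
  nothing-reached n b with b <ᵇ suc n
  ... | true  = ∑-zero (suc b)
  ... | false = refl

  risingAt-transfer : ∀ n b σ → Bounded n σ →
                      ∑[ a < suc n ] risingAt b (step σ a) ≡ (if b <ᵇ suc n then ∑[ b′ < suc b ] risingAt b′ σ else 0)
  risingAt-transfer n b (rising M m) (_ , m≤M) = begin
    ∑[ a < suc n ] risingAt b (step (rising M m) a)  ≡⟨ ∑-cong (suc n) (λ a _ → risingAt-step b a m≤M) ⟩
    ∑[ a < suc n ] (if a ≡ᵇ b then reached else 0)   ≡⟨ ∑-indicator (suc n) b reached ⟩
    (if b <ᵇ suc n then reached else 0)              ≡⟨ cong (λ x → if b <ᵇ suc n then x else 0) (sym (∑-indicator (suc b) M 1)) ⟩
    (if b <ᵇ suc n then ∑[ b′ < suc b ] risingAt b′ (rising M m) else 0) ∎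
    where
    open ≡-Reasoning
    reached = if M <ᵇ suc b then 1 else 0
  risingAt-transfer n b (frozen V) _ =
    trans (∑-cong (suc n) (λ a _ → vanishes a)) (trans (∑-zero (suc n)) (sym (nothing-reached n b)))
    where
    vanishes : ∀ a → risingAt b (step (frozen V) a) ≡ 0
    vanishes a with a ≡ᵇ V
    ... | true  = refl
    ... | false = refl
  risingAt-transfer n b closed _ = trans (∑-step-failed (risingAt b) n refl) (sym (nothing-reached n b))
  risingAt-transfer n b failed _ = trans (∑-step-failed (risingAt b) n refl) (sym (nothing-reached n b))

  risingCount frozenCount gapSum slackSum headroomSum : ℕ → ℕ
  risingCount n = total isRising n
  frozenCount n = total isFrozen n
  gapSum      n = total gapWidth n
  slackSum    n = total (slack n) n
  headroomSum n = total (headroom n) n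

  risingAtCount : ℕ → ℕ → ℕ
  risingAtCount n b = total (risingAt b) n

  total-+ : ∀ f g n → total (λ σ → f σ + g σ) n ≡ total f n + total g n
  total-+ f g n = ∑ᴸ-distrib-+ (invSeqs n) (f ∘ run) (g ∘ run)

  I-suc : ∀ n → I (suc n) ≡ suc n * risingCount n + frozenCount n
  I-suc n = begin
    I (suc n)                                           ≡⟨ I≡total-alive (suc n) ⟩
    total alive (suc n)                                 ≡⟨ transfer n alive _ (alive-transfer n) ⟩
    total (λ σ → isRising σ * suc n + isFrozen σ) n     ≡⟨ total-+ (λ σ → isRising σ * suc n) isFrozen n ⟩
    total (λ σ → isRising σ * suc n) n + frozenCount n  ≡⟨ cong (_+ frozenCount n) scale ⟩
    suc n * risingCount n + frozenCount n               ∎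
    where
    open ≡-Reasoning
    scale : total (λ σ → isRising σ * suc n) n ≡ suc n * risingCount n
    scale = trans (∑ᴸ-cong (All.universal (λ s → *-comm (isRising (run s)) (suc n)) (invSeqs n)))
                  (∑ᴸ-distribˡ-* (invSeqs n) (suc n) (isRising ∘ run))

  frozenCount-suc : ∀ n → frozenCount (suc n) ≡ frozenCount n + gapSum n
  frozenCount-suc n = trans (transfer n isFrozen _ (isFrozen-transfer n)) (total-+ isFrozen gapWidth n)

  gapSum-suc : ∀ n → gapSum (suc n) ≡ gapSum n + slackSum n
  gapSum-suc n = trans (transfer n gapWidth _ (gapWidth-transfer n)) (total-+ gapWidth (slack n) n)

  risingCount-suc : ∀ n → risingCount (suc n) ≡ headroomSum n
  risingCount-suc n = transfer n isRising (headroom n) (isRising-transfer n)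

  headroomSum-suc : ∀ n → headroomSum (suc n) ≡ slackSum n + 2 * headroomSum n
  headroomSum-suc n = begin
    headroomSum (suc n)                                  ≡⟨ transfer n (headroom (suc n)) _ (headroom-transfer n) ⟩
    total (λ σ → slack n σ + 2 * headroom n σ) n         ≡⟨ total-+ (slack n) (λ σ → 2 * headroom n σ) n ⟩
    slackSum n + total (λ σ → 2 * headroom n σ) n        ≡⟨ cong (slackSum n +_) (∑ᴸ-distribˡ-* (invSeqs n) 2 (headroom n ∘ run)) ⟩
    slackSum n + 2 * headroomSum n                       ∎
    where open ≡-Reasoning

  risingAtCount-suc-≤ : ∀ {n b} → b ≤ n → risingAtCount (suc n) b ≡ ∑[ b′ < suc b ] risingAtCount n b′
  risingAtCount-suc-≤ {n} {b} b≤n =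
    trans (transfer n (risingAt b) below reached) (∑ᴸ-∑-comm (invSeqs n) (suc b) (λ s b′ → risingAt b′ (run s)))
    where
    below : State → ℕ
    below σ = ∑[ b′ < suc b ] risingAt b′ σ
    reached : ∀ σ → Bounded n σ → ∑[ a < suc n ] risingAt b (step σ a) ≡ below σ
    reached σ bnd = trans (risingAt-transfer n b σ bnd) (cong (if_then below σ else 0) (dec-true (b <? suc n) (s≤s b≤n)))

  risingAtCount-suc-> : ∀ {n b} → n < b → risingAtCount (suc n) b ≡ 0
  risingAtCount-suc-> {n} {b} n<b = trans (transfer n (risingAt b) (λ _ → 0) unreached) (∑ᴸ-zero (invSeqs n))
    where
    unreached : ∀ σ → Bounded n σ → ∑[ a < suc n ] risingAt b (step σ a) ≡ 0
    unreached σ bnd = trans (risingAt-transfer n b σ bnd)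
                            (cong (if_then ∑[ b′ < suc b ] risingAt b′ σ else 0) (dec-false (b <? suc n) (<⇒≱ (s≤s n<b))))

  risingCount-∑ : ∀ n → risingCount n ≡ ∑[ b < suc n ] risingAtCount n b
  risingCount-∑ n = trans (∑ᴸ-cong (All.map (λ {s} (_ , bnd) → by-top (run s) bnd) (all-reachable n)))
                          (∑ᴸ-∑-comm (invSeqs n) (suc n) (λ s b → risingAt b (run s)))
    where
    by-top : ∀ σ → Bounded n σ → isRising σ ≡ ∑[ b < suc n ] risingAt b σ
    by-top (rising M m) (M≤n , _) =
      sym (trans (∑-indicator (suc n) M 1) (cong (if_then 1 else 0) (dec-true (M <? suc n) (s≤s M≤n))))
    by-top (frozen _)   _ = sym (∑-zero (suc n))
    by-top closed       _ = sym (∑-zero (suc n))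
    by-top failed       _ = sym (∑-zero (suc n))

  -- Ballot and Catalan numbers

  ballot : ℕ → ℕ → ℕ
  ballot x       zero    = 1
  ballot zero    (suc y) = 0
  ballot (suc x) (suc y) = if y <ᵇ suc x then ballot x (suc y) + ballot (suc x) y else 0

  ballot-above-diagonal : ∀ {x y} → x < y → ballot x y ≡ 0
  ballot-above-diagonal {zero}  {suc y} _          = refl
  ballot-above-diagonal {suc x} {suc y} (s≤s x<y) rewrite dec-false (y <? suc x) (<⇒≱ (s≤s x<y)) = refl

  ballot-suc : ∀ {x y} → y ≤ x → ballot (suc x) (suc y) ≡ ballot x (suc y) + ballot (suc x) y
  ballot-suc {x} {y} y≤x rewrite dec-true (y <? suc x) (s≤s y≤x) = refl

  ballot-row : ∀ x y → y ≤ suc x → ballot (suc x) y ≡ ∑[ b < suc y ] ballot x b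
  ballot-row x zero    _         = refl
  ballot-row x (suc y) (s≤s y≤x) = begin
    ballot (suc x) (suc y)                   ≡⟨ ballot-suc y≤x ⟩
    ballot x (suc y) + ballot (suc x) y      ≡⟨ cong (ballot x (suc y) +_) (ballot-row x y (m≤n⇒m≤1+n y≤x)) ⟩
    ballot x (suc y) + ∑[ b < suc y ] ballot x b ≡⟨ +-comm (ballot x (suc y)) _ ⟩
    ∑[ b < suc y ] ballot x b + ballot x (suc y) ≡⟨ sym (∑-last (suc y) (ballot x)) ⟩
    ∑[ b < suc (suc y) ] ballot x b          ∎
    where open ≡-Reasoning

  risingAtCount≡ballot : ∀ n b → risingAtCount (suc n) b ≡ ballot n b
  risingAtCount≡ballot zero    zero    = refl
  risingAtCount≡ballot zero    (suc b) = refl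
  risingAtCount≡ballot (suc n) b with b ≤? suc n
  ... | yes b≤1+n = begin
    risingAtCount (suc (suc n)) b                    ≡⟨ risingAtCount-suc-≤ b≤1+n ⟩
    ∑[ b′ < suc b ] risingAtCount (suc n) b′         ≡⟨ ∑-cong (suc b) (λ b′ _ → risingAtCount≡ballot n b′) ⟩
    ∑[ b′ < suc b ] ballot n b′                      ≡⟨ sym (ballot-row n b b≤1+n) ⟩
    ballot (suc n) b                                 ∎
    where open ≡-Reasoning
  ... | no b≰1+n = trans (risingAtCount-suc-> (≰⇒> b≰1+n)) (sym (ballot-above-diagonal (≰⇒> b≰1+n)))

  catalan : ℕ → ℕ
  catalan n = ballot n n

  risingCount≡catalan : ∀ n → risingCount n ≡ catalan n
  risingCount≡catalan zero    = refl
  risingCount≡catalan (suc n) = begin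
    risingCount (suc n)                              ≡⟨ risingCount-∑ (suc n) ⟩
    ∑[ b < suc (suc n) ] risingAtCount (suc n) b     ≡⟨ ∑-cong (suc (suc n)) (λ b _ → risingAtCount≡ballot n b) ⟩
    ∑[ b < suc (suc n) ] ballot n b                  ≡⟨ sym (ballot-row n (suc n) ≤-refl) ⟩
    catalan (suc n)                                  ∎
    where open ≡-Reasoning

  ballotOff : ℕ → ℕ → ℕ
  ballotOff d j = ballot (d + j) j

  ballotOff-diagonal : ∀ j → ballotOff 0 (suc j) ≡ ballotOff 1 j
  ballotOff-diagonal j = trans (ballot-suc {j} {j} ≤-refl) (cong (_+ ballot (suc j) j) (ballot-above-diagonal (n<1+n j)))

  ballotOff-suc : ∀ d j → ballotOff (suc d) (suc j) ≡ ballotOff (suc (suc d)) j + ballotOff d (suc j)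
  ballotOff-suc d j = begin
    ballot (suc (d + suc j)) (suc j)                           ≡⟨ ballot-suc {d + suc j} {j} (≤-trans (n≤1+n j) (m≤n+m (suc j) d)) ⟩
    ballot (d + suc j) (suc j) + ballot (suc (d + suc j)) j    ≡⟨ +-comm (ballot (d + suc j) (suc j)) _ ⟩
    ballot (suc (d + suc j)) j + ballot (d + suc j) (suc j)    ≡⟨ cong (λ x → ballot (suc x) j + ballot (d + suc j) (suc j)) (+-suc d j) ⟩
    ballot (suc (suc (d + j))) j + ballot (d + suc j) (suc j)  ∎
    where open ≡-Reasoning

  ballotOff-convolution : ∀ y d → ballotOff (suc d) y ≡ ∑[ k < suc y ] (catalan k * ballotOff d (y ∸ k))
  ballotOff-convolution zero    d    = refl
  ballotOff-convolution (suc y) zero = begin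
    ballotOff 1 (suc y)
      ≡⟨ ballotOff-suc 0 y ⟩
    ballotOff 2 y + ballotOff 0 (suc y)
      ≡⟨ cong (_+ ballotOff 0 (suc y)) (ballotOff-convolution y 1) ⟩
    ∑[ k < suc y ] (catalan k * ballotOff 1 (y ∸ k)) + catalan (suc y)
      ≡⟨ cong₂ _+_ (∑-cong (suc y) (λ k _ → cong (catalan k *_) (sym (ballotOff-diagonal (y ∸ k)))))
                   (sym (*-identityʳ _)) ⟩
    ∑[ k < suc y ] (catalan k * ballotOff 0 (suc (y ∸ k))) + catalan (suc y) * 1
      ≡⟨ sym (∑-antidiagonal-last (λ k j → catalan k * ballotOff 0 j) y) ⟩
    ∑[ k < suc (suc y) ] (catalan k * ballotOff 0 (suc y ∸ k))
      ∎
    where open ≡-Reasoning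
  ballotOff-convolution (suc y) (suc d) = begin
    ballotOff (suc (suc d)) (suc y)
      ≡⟨ ballotOff-suc (suc d) y ⟩
    ballotOff (suc (suc (suc d))) y + ballotOff (suc d) (suc y)
      ≡⟨ cong₂ _+_ (ballotOff-convolution y (suc (suc d))) (ballotOff-convolution (suc y) d) ⟩
    ∑[ k < suc y ] f k + ∑[ k < suc (suc y) ] (catalan k * ballotOff d (suc y ∸ k))
      ≡⟨ cong (∑[ k < suc y ] f k +_) (∑-antidiagonal-last (λ k j → catalan k * ballotOff d j) y) ⟩
    ∑[ k < suc y ] f k + (∑[ k < suc y ] g k + catalan (suc y) * 1)
      ≡⟨ sym (+-assoc (∑[ k < suc y ] f k) (∑[ k < suc y ] g k) _) ⟩
    ∑[ k < suc y ] f k + ∑[ k < suc y ] g k + catalan (suc y) * 1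
      ≡⟨ cong (_+ catalan (suc y) * 1) (sym (∑-distrib-+ (suc y) f g)) ⟩
    ∑[ k < suc y ] (f k + g k) + catalan (suc y) * 1
      ≡⟨ cong (_+ catalan (suc y) * 1) (∑-cong (suc y) (λ k _ → merge k)) ⟩
    ∑[ k < suc y ] (catalan k * ballotOff (suc d) (suc (y ∸ k))) + catalan (suc y) * 1
      ≡⟨ sym (∑-antidiagonal-last (λ k j → catalan k * ballotOff (suc d) j) y) ⟩
    ∑[ k < suc (suc y) ] (catalan k * ballotOff (suc d) (suc y ∸ k))
      ∎
    where
    open ≡-Reasoning
    f g : ℕ → ℕ
    f k = catalan k * ballotOff (suc (suc d)) (y ∸ k)
    g k = catalan k * ballotOff d (suc (y ∸ k))
    merge : ∀ k → f k + g k ≡ catalan k * ballotOff (suc d) (suc (y ∸ k))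
    merge k = trans (sym (*-distribˡ-+ (catalan k) _ _)) (cong (catalan k *_) (sym (ballotOff-suc d (y ∸ k))))

  catalan-convolution : ∀ y → catalan (suc y) ≡ ∑[ k < suc y ] (catalan k * catalan (y ∸ k))
  catalan-convolution y = trans (ballotOff-diagonal y) (ballotOff-convolution y 0)

  pascal : ∀ n k → suc n C suc k ≡ n C k + n C suc k
  pascal n k = sym (nCk+nC[k+1]≡[n+1]C[k+1] n k)

  absorption : ∀ m k → suc k * (m C suc k) + k * (m C k) ≡ m * (m C k)
  absorption zero    zero    = refl
  absorption zero    (suc k) = cong₂ _+_ (*-zeroʳ (suc (suc k))) (*-zeroʳ (suc k))
  absorption (suc m) zero    = begin
    1 * (suc m C 1) + 0   ≡⟨ trans (+-identityʳ _) (*-identityˡ _) ⟩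
    suc m C 1           ≡⟨ nC1≡n (suc m) ⟩
    suc m               ≡⟨ sym (*-identityʳ (suc m)) ⟩
    suc m * 1           ∎
    where open ≡-Reasoning
  absorption (suc m) (suc k) = begin
    suc (suc k) * (suc m C suc (suc k)) + suc k * (suc m C suc k)
        ≡⟨ cong₂ (λ x y → suc (suc k) * x + suc k * y) (pascal m (suc k)) (pascal m k) ⟩
    suc (suc k) * (B₁ + B₂) + suc k * (B₀ + B₁)
        ≡⟨ regroup k B₀ B₁ B₂ ⟩
    (suc (suc k) * B₂ + suc k * B₁) + (suc k * B₁ + k * B₀) + B₁ + B₀
        ≡⟨ cong₂ (λ x y → x + y + B₁ + B₀) (absorption m (suc k)) (absorption m k) ⟩
    m * B₁ + m * B₀ + B₁ + B₀
        ≡⟨ collect m B₀ B₁ ⟩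
    suc m * (B₀ + B₁)
        ≡⟨ cong (suc m *_) (sym (pascal m k)) ⟩
    suc m * (suc m C suc k) ∎
    where
    open ≡-Reasoning
    B₀ = m C k
    B₁ = m C suc k
    B₂ = m C suc (suc k)
    regroup : ∀ k b₀ b₁ b₂ → suc (suc k) * (b₁ + b₂) + suc k * (b₀ + b₁)
                             ≡ (suc (suc k) * b₂ + suc k * b₁) + (suc k * b₁ + k * b₀) + b₁ + b₀
    regroup = solve-∀
    collect : ∀ m b₀ b₁ → m * b₁ + m * b₀ + b₁ + b₀ ≡ suc m * (b₀ + b₁)
    collect = solve-∀

  ballot-binomial : ∀ x y → y ≤ suc x → ballot x y + (x + y) C suc x ≡ (x + y) C y
  ballot-binomial x       zero          _ = cong suc (k>n⇒nCk≡0 (s≤s (≤-reflexive (+-identityʳ x))))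
  ballot-binomial zero    (suc zero)    _ = refl
  ballot-binomial zero    (suc (suc _)) (s≤s ())
  ballot-binomial (suc x) (suc y)       (s≤s y≤1+x) with m≤n⇒m<n∨m≡n y≤1+x
  ... | inj₂ refl     = cong (_+ (suc x + suc (suc x)) C suc (suc x)) (ballot-above-diagonal (n<1+n (suc x)))
  ... | inj₁ (s≤s y≤x) = begin
    ballot (suc x) (suc y) + suc N C suc (suc x)              ≡⟨ cong₂ _+_ (ballot-suc y≤x) (pascal N (suc x)) ⟩
    T₁ + T₂ + (N C suc x + N C suc (suc x))                   ≡⟨ regroup T₁ T₂ _ _ ⟩
    (T₂ + N C suc (suc x)) + (T₁ + N C suc x)                 ≡⟨ cong₂ _+_ lower (ballot-binomial x (suc y) (s≤s y≤x)) ⟩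
    N C y + N C suc y                                         ≡⟨ sym (pascal N y) ⟩
    suc N C suc y                                             ∎
    where
    open ≡-Reasoning
    N = x + suc y
    T₁ = ballot x (suc y)
    T₂ = ballot (suc x) y
    lower : T₂ + N C suc (suc x) ≡ N C y
    lower = subst (λ n → T₂ + n C suc (suc x) ≡ n C y) (sym (+-suc x y))
                  (ballot-binomial (suc x) y (m≤n⇒m≤1+n (m≤n⇒m≤1+n y≤x)))
    regroup : ∀ a b c d → a + b + (c + d) ≡ (b + d) + (a + c)
    regroup = solve-∀

  suc-*-catalan : ∀ n → suc n * catalan n ≡ (n + n) C n
  suc-*-catalan n = +-cancelʳ-≡ (n * b) _ _ (begin
    suc n * catalan n + n * b             ≡⟨ cong (suc n * catalan n +_) (sym shifted) ⟩
    suc n * catalan n + suc n * b′        ≡⟨ sym (*-distribˡ-+ (suc n) (catalan n) b′) ⟩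
    suc n * (catalan n + b′)              ≡⟨ cong (suc n *_) (ballot-binomial n n (n≤1+n n)) ⟩
    suc n * b                             ∎)
    where
    open ≡-Reasoning
    b  = (n + n) C n
    b′ = (n + n) C suc n
    shifted : suc n * b′ ≡ n * b
    shifted = +-cancelʳ-≡ (n * b) _ _ (trans (absorption (n + n) n) (*-distribʳ-+ b n n))

  central-binomial-suc : ∀ n → (suc n + suc n) C suc n + 2 * catalan n ≡ 4 * ((n + n) C n)
  central-binomial-suc n = begin
    (suc n + suc n) C suc n + 2 * catalan n                ≡⟨ cong (λ x → suc x C suc n + 2 * catalan n) (+-suc n n) ⟩
    suc s C suc n + 2 * catalan n                          ≡⟨ cong (_+ 2 * catalan n) (pascal s n) ⟩
    s C n + s C suc n + 2 * catalan n                      ≡⟨ cong (λ x → x + s C suc n + 2 * catalan n) symmetric ⟩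
    s C suc n + s C suc n + 2 * catalan n                  ≡⟨ cong (λ x → x + x + 2 * catalan n) (pascal (n + n) n) ⟩
    (b + b′) + (b + b′) + 2 * catalan n                    ≡⟨ regroup b b′ (catalan n) ⟩
    2 * b + 2 * (catalan n + b′)                           ≡⟨ cong (λ x → 2 * b + 2 * x) (ballot-binomial n n (n≤1+n n)) ⟩
    2 * b + 2 * b                                          ≡⟨ double b ⟩
    4 * b                                                  ∎
    where
    open ≡-Reasoning
    s  = suc (n + n)
    b  = (n + n) C n
    b′ = (n + n) C suc n
    symmetric : s C n ≡ s C suc n
    symmetric = trans (nCk≡nC[n∸k] (m≤n⇒m≤1+n (m≤m+n n n))) (cong (s C_) (suc[m+n]∸m≡suc[n] n n))
    regroup : ∀ b b′ c → (b + b′) + (b + b′) + 2 * c ≡ 2 * b + 2 * (c + b′)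
    regroup = solve-∀
    double : ∀ b → 2 * b + 2 * b ≡ 4 * b
    double = solve-∀

  catalan-recurrence : ∀ n → suc (suc n) * catalan (suc n) + 2 * catalan n ≡ 4 * (suc n * catalan n)
  catalan-recurrence n = begin
    suc (suc n) * catalan (suc n) + 2 * catalan n  ≡⟨ cong (_+ 2 * catalan n) (suc-*-catalan (suc n)) ⟩
    (suc n + suc n) C suc n + 2 * catalan n        ≡⟨ central-binomial-suc n ⟩
    4 * ((n + n) C n)                              ≡⟨ cong (4 *_) (sym (suc-*-catalan n)) ⟩
    4 * (suc n * catalan n)                        ∎
    where open ≡-Reasoning

  I-suc-catalan : ∀ n → I (suc n) ≡ suc n * catalan n + frozenCount n
  I-suc-catalan n = trans (I-suc n) (cong (λ x → suc n * x + frozenCount n) (risingCount≡catalan n))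

  catalan-slack : ∀ n → catalan (suc (suc n)) ≡ slackSum n + 2 * catalan (suc n)
  catalan-slack n = begin
    catalan (suc (suc n))                   ≡⟨ sym (risingCount≡catalan (suc (suc n))) ⟩
    risingCount (suc (suc n))               ≡⟨ risingCount-suc (suc n) ⟩
    headroomSum (suc n)                     ≡⟨ headroomSum-suc n ⟩
    slackSum n + 2 * headroomSum n          ≡⟨ cong (λ x → slackSum n + 2 * x) headroom≡catalan ⟩
    slackSum n + 2 * catalan (suc n)        ∎
    where
    open ≡-Reasoning
    headroom≡catalan : headroomSum n ≡ catalan (suc n)
    headroom≡catalan = trans (sym (risingCount-suc n)) (risingCount≡catalan (suc n))

module Series where

  open import Defs
  open import Data.Nat as ℕ using (ℕ; zero; suc; _∸_)
  import Data.Nat.Properties as ℕP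
  open import Data.Integer using (ℤ; +_; -_; _+_; _*_; _-_)
  import Data.Integer.Properties as ℤP
  open import Data.Integer.Tactic.RingSolver using (solve-∀)
  open import Data.List using (List; []; _∷_; map; upTo)
  open import Relation.Binary.PropositionalEquality
  open import Function using (_∘_)
  open Enumeration using (catalan; catalan-convolution; catalan-recurrence; I-suc-catalan; frozenCount; gapSum; slackSum;
                          frozenCount-suc; gapSum-suc; catalan-slack)
  module ℤ∑ = Sums ℤP.+-*-semiring
  open ℤ∑ using (∑ᴸ)

  sumℤ-map : ∀ (h : ℕ → ℤ) xs → sumℤ (map h xs) ≡ ∑ᴸ xs h
  sumℤ-map h []       = refl
  sumℤ-map h (x ∷ xs) = cong (λ t → h x + t) (sumℤ-map h xs)

  ⊛-as-∑ : ∀ f g n → (f ⊛ g) n ≡ ℤ∑.∑[ k < suc n ] (f k * g (n ∸ k))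
  ⊛-as-∑ f g n = trans (sumℤ-map term (upTo (suc n))) (ℤ∑.∑ᴸ-applyUpTo (λ k → k) (suc n) term)
    where
    term : ℕ → ℤ
    term k = f k * g (n ∸ k)

  ⊛-congˡ : ∀ {f f′} g → f ≐ f′ → f ⊛ g ≐ f′ ⊛ g
  ⊛-congˡ {f} {f′} g f≐f′ n = begin
    (f ⊛ g) n                                   ≡⟨ ⊛-as-∑ f g n ⟩
    ℤ∑.∑[ k < suc n ] (f k * g (n ∸ k))          ≡⟨ ℤ∑.∑-cong (suc n) (λ k _ → cong (_* g (n ∸ k)) (f≐f′ k)) ⟩
    ℤ∑.∑[ k < suc n ] (f′ k * g (n ∸ k))         ≡⟨ sym (⊛-as-∑ f′ g n) ⟩
    (f′ ⊛ g) n                                  ∎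
    where open ≡-Reasoning

  infixr 5 _≐∘_
  _≐∘_ : ∀ {f g h : PS} → f ≐ g → g ≐ h → f ≐ h
  (f≐g ≐∘ g≐h) n = trans (f≐g n) (g≐h n)

  mulPoly : List ℤ → PS → PS
  mulPoly []       g n       = + 0
  mulPoly (a ∷ cs) g zero    = a * g 0
  mulPoly (a ∷ cs) g (suc n) = a * g (suc n) + mulPoly cs g n

  poly-⊛ : ∀ cs g → poly cs ⊛ g ≐ mulPoly cs g
  poly-⊛ []       g n       = trans (⊛-as-∑ (poly []) g n) (ℤ∑.∑-zero (suc n))
  poly-⊛ (a ∷ cs) g zero    = ℤP.+-identityʳ (a * g 0)
  poly-⊛ (a ∷ cs) g (suc n) = trans (⊛-as-∑ (poly (a ∷ cs)) g (suc n))
                                    (cong (λ t → a * g (suc n) + t) (trans (sym (⊛-as-∑ (poly cs) g n)) (poly-⊛ cs g n)))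

  infixl 6 _+ₚ_
  infixl 7 _·ₚ_

  _+ₚ_ : List ℤ → List ℤ → List ℤ
  []       +ₚ ys       = ys
  (x ∷ xs) +ₚ []       = x ∷ xs
  (x ∷ xs) +ₚ (y ∷ ys) = x + y ∷ xs +ₚ ys

  _·ₚ_ : List ℤ → List ℤ → List ℤ
  []       ·ₚ ys = []
  (x ∷ xs) ·ₚ ys = map (x *_) ys +ₚ (+ 0 ∷ xs ·ₚ ys)

  poly-+ₚ : ∀ xs ys n → poly (xs +ₚ ys) n ≡ poly xs n + poly ys n
  poly-+ₚ []       ys       n       = sym (ℤP.+-identityˡ (poly ys n))
  poly-+ₚ (x ∷ xs) []       n       = sym (ℤP.+-identityʳ (poly (x ∷ xs) n))
  poly-+ₚ (x ∷ xs) (y ∷ ys) zero    = refl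
  poly-+ₚ (x ∷ xs) (y ∷ ys) (suc n) = poly-+ₚ xs ys n

  poly-map-* : ∀ x ys n → poly (map (x *_) ys) n ≡ x * poly ys n
  poly-map-* x []       n       = sym (ℤP.*-zeroʳ x)
  poly-map-* x (y ∷ ys) zero    = refl
  poly-map-* x (y ∷ ys) (suc n) = poly-map-* x ys n

  mulPoly-poly : ∀ xs ys → mulPoly xs (poly ys) ≐ poly (xs ·ₚ ys)
  mulPoly-poly []       ys n       = refl
  mulPoly-poly (x ∷ xs) ys zero    = sym (trans (poly-+ₚ (map (x *_) ys) (+ 0 ∷ xs ·ₚ ys) 0)
                                               (trans (ℤP.+-identityʳ _) (poly-map-* x ys 0)))
  mulPoly-poly (x ∷ xs) ys (suc n) = sym (trans (poly-+ₚ (map (x *_) ys) (+ 0 ∷ xs ·ₚ ys) (suc n))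
                                               (cong₂ _+_ (poly-map-* x ys (suc n)) (sym (mulPoly-poly xs ys n))))

  poly-⊛-poly : ∀ xs ys → poly xs ⊛ poly ys ≐ poly (xs ·ₚ ys)
  poly-⊛-poly xs ys n = trans (poly-⊛ xs (poly ys) n) (mulPoly-poly xs ys n)

  module ℕ∑ = Sums ℕP.+-*-semiring

  ∑-pos : ∀ n (f : ℕ → ℕ) → ℤ∑.∑[ k < n ] (+ f k) ≡ + ℕ∑.∑< n f
  ∑-pos zero    f = refl
  ∑-pos (suc n) f = trans (cong (λ t → + f 0 + t) (∑-pos n (f ∘ suc))) (sym (ℤP.pos-+ (f 0) _))

  S : PS
  S zero    = + 1
  S (suc k) = - (+ 2 * + catalan k)

  S⊛S : S ⊛ S ≐ poly (+ 1 ∷ - (+ 4) ∷ [])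
  S⊛S zero          = refl
  S⊛S (suc zero)    = refl
  S⊛S (suc (suc y)) = begin
    (S ⊛ S) (suc (suc y))
      ≡⟨ ⊛-as-∑ S S (suc (suc y)) ⟩
    S 0 * S (suc (suc y)) + ℤ∑.∑[ k < suc (suc y) ] (S (suc k) * S (suc y ∸ k))
      ≡⟨ cong (λ t → S 0 * S (suc (suc y)) + t) (ℤ∑.∑-antidiagonal-last (λ k j → S (suc k) * S j) y) ⟩
    S 0 * S (suc (suc y)) + (ℤ∑.∑[ k < suc y ] (S (suc k) * S (suc (y ∸ k))) + S (suc (suc y)) * S 0)
      ≡⟨ cong (λ t → S 0 * S (suc (suc y)) + (t + S (suc (suc y)) * S 0)) convolution ⟩
    S 0 * S (suc (suc y)) + (+ 4 * + catalan (suc y) + S (suc (suc y)) * S 0)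
      ≡⟨ cancel (+ catalan (suc y)) ⟩
    + 0
      ∎
    where
    open ≡-Reasoning
    square : ∀ a b → - (+ 2 * a) * - (+ 2 * b) ≡ + 4 * (a * b)
    square = solve-∀
    cancel : ∀ c → + 1 * - (+ 2 * c) + (+ 4 * c + - (+ 2 * c) * + 1) ≡ + 0
    cancel = solve-∀
    products : ∀ k → S (suc k) * S (suc (y ∸ k)) ≡ + 4 * + (catalan k ℕ.* catalan (y ∸ k))
    products k = trans (square (+ catalan k) (+ catalan (y ∸ k)))
                       (cong (+ 4 *_) (sym (ℤP.pos-* (catalan k) (catalan (y ∸ k)))))
    convolution : ℤ∑.∑[ k < suc y ] (S (suc k) * S (suc (y ∸ k))) ≡ + 4 * + catalan (suc y)
    convolution = begin
      ℤ∑.∑[ k < suc y ] (S (suc k) * S (suc (y ∸ k)))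
        ≡⟨ ℤ∑.∑-cong (suc y) (λ k _ → products k) ⟩
      ℤ∑.∑[ k < suc y ] (+ 4 * + (catalan k ℕ.* catalan (y ∸ k)))
        ≡⟨ ℤ∑.∑-distribˡ-* (suc y) (+ 4) (λ k → + (catalan k ℕ.* catalan (y ∸ k))) ⟩
      + 4 * ℤ∑.∑[ k < suc y ] (+ (catalan k ℕ.* catalan (y ∸ k)))
        ≡⟨ cong (+ 4 *_) (∑-pos (suc y) (λ k → catalan k ℕ.* catalan (y ∸ k))) ⟩
      + 4 * + ℕ∑.∑[ k < suc y ] (catalan k ℕ.* catalan (y ∸ k))
        ≡⟨ cong (λ t → + 4 * + t) (sym (catalan-convolution y)) ⟩
      + 4 * + catalan (suc y)
        ∎

  -- Multiplying by (1 - z)² undoes the two summations hidden in k, and (1 - 4z) turns e into s.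
  module CoefficientIdentity
    (f s c e k l : ℕ → ℤ)
    (f-suc : ∀ n → f (suc n) ≡ e n + k n)
    (s-suc : ∀ n → s (suc n) ≡ - (+ 2 * c n))
    (e-suc : ∀ n → e (suc n) ≡ + 4 * e n - + 2 * c n)
    (k-suc : ∀ n → k (suc n) ≡ k n + l n)
    (l-suc : ∀ n → l (suc n) ≡ l n + (c (suc (suc n)) - + 2 * c (suc n)))
    where

    polynomial-identity : ∀ c₀ c₁ c₂ c₃ e₀ k₀ l₀ →
      let e₁ = + 4 * e₀ - + 2 * c₀
          e₂ = + 4 * e₁ - + 2 * c₁
          e₃ = + 4 * e₂ - + 2 * c₂
          l₁ = l₀ + (c₂ - + 2 * c₁)
          l₂ = l₁ + (c₃ - + 2 * c₂)
          k₁ = k₀ + l₀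
          k₂ = k₁ + l₁
          k₃ = k₂ + l₂
      in + 2 * (e₃ + k₃) + (- (+ 12) * (e₂ + k₂) + (+ 18 * (e₁ + k₁) + (- (+ 8) * (e₀ + k₀) + + 0)))
         ≡ + 0 - (+ 1 * - (+ 2 * c₃) + (- (+ 8) * - (+ 2 * c₂) + (+ 12 * - (+ 2 * c₁) + (- (+ 2) * - (+ 2 * c₀) + + 0))))
    polynomial-identity = solve-∀

    coefficient-identity : ∀ m → mulPoly (+ 2 ∷ - (+ 12) ∷ + 18 ∷ - (+ 8) ∷ []) f (4 ℕ.+ m)
                                  ≡ + 0 - mulPoly (+ 1 ∷ - (+ 8) ∷ + 12 ∷ - (+ 2) ∷ []) s (4 ℕ.+ m)
    coefficient-identity m
      rewrite f-suc (3 ℕ.+ m) | f-suc (2 ℕ.+ m) | f-suc (1 ℕ.+ m) | f-suc m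
            | s-suc (3 ℕ.+ m) | s-suc (2 ℕ.+ m) | s-suc (1 ℕ.+ m) | s-suc m
            | e-suc (2 ℕ.+ m) | e-suc (1 ℕ.+ m) | e-suc m
            | k-suc (2 ℕ.+ m) | k-suc (1 ℕ.+ m) | k-suc m
            | l-suc (1 ℕ.+ m) | l-suc m
      = polynomial-identity (c m) (c (1 ℕ.+ m)) (c (2 ℕ.+ m)) (c (3 ℕ.+ m)) (e m) (k m) (l m)

  pos-moved : ∀ {a b c} → a ℕ.+ c ≡ b → + a ≡ + b - + c
  pos-moved {a} {b} {c} a+c≡b = trans (sym (cancel (+ a) (+ c))) (cong (_- + c) (trans (sym (ℤP.pos-+ a c)) (cong +_ a+c≡b)))
    where
    cancel : ∀ x y → x + y - y ≡ x
    cancel = solve-∀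

  C E K L : ℕ → ℤ
  C n = + catalan n
  E n = + (suc n ℕ.* catalan n)
  K n = + frozenCount n
  L n = + gapSum n

  F-suc : ∀ n → F (suc n) ≡ E n + K n
  F-suc n = trans (cong +_ (I-suc-catalan n)) (ℤP.pos-+ (suc n ℕ.* catalan n) (frozenCount n))

  E-suc : ∀ n → E (suc n) ≡ + 4 * E n - + 2 * C n
  E-suc n = trans (pos-moved (catalan-recurrence n)) (cong₂ _-_ (ℤP.pos-* 4 (suc n ℕ.* catalan n)) (ℤP.pos-* 2 (catalan n)))

  K-suc : ∀ n → K (suc n) ≡ K n + L n
  K-suc n = trans (cong +_ (frozenCount-suc n)) (ℤP.pos-+ (frozenCount n) (gapSum n))

  L-suc : ∀ n → L (suc n) ≡ L n + (C (suc (suc n)) - + 2 * C (suc n))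
  L-suc n = begin
    + gapSum (suc n)                   ≡⟨ cong +_ (gapSum-suc n) ⟩
    + (gapSum n ℕ.+ slackSum n)        ≡⟨ ℤP.pos-+ (gapSum n) (slackSum n) ⟩
    L n + + slackSum n                 ≡⟨ cong (λ t → L n + t) (pos-moved (sym (catalan-slack n))) ⟩
    L n + (C (suc (suc n)) - + (2 ℕ.* catalan (suc n)))
                                       ≡⟨ cong (λ t → L n + (C (suc (suc n)) - t)) (ℤP.pos-* 2 (catalan (suc n))) ⟩
    L n + (C (suc (suc n)) - + 2 * C (suc n)) ∎
    where open ≡-Reasoning

  open CoefficientIdentity F S C E K L F-suc (λ _ → refl) E-suc K-suc L-suc using (coefficient-identity)

  coefficientwise-identity : ∀ n → mulPoly (+ 2 ∷ - (+ 12) ∷ + 18 ∷ - (+ 8) ∷ []) F n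
                                   ≡ poly (+ 3 ∷ - (+ 20) ∷ + 36 ∷ - (+ 16) ∷ []) n
                                     - mulPoly (+ 1 ∷ - (+ 8) ∷ + 12 ∷ - (+ 2) ∷ []) S n
  coefficientwise-identity 0 = refl
  coefficientwise-identity 1 = refl
  coefficientwise-identity 2 = refl
  coefficientwise-identity 3 = refl
  coefficientwise-identity (suc (suc (suc (suc m)))) = coefficient-identity m

  generating-function-identity :
    poly (+ 2 ∷ []) ⊛ poly (+ 1 ∷ - (+ 1) ∷ []) ⊛ poly (+ 1 ∷ - (+ 1) ∷ []) ⊛ poly (+ 1 ∷ - (+ 4) ∷ []) ⊛ F
    ≐ poly (+ 1 ∷ - (+ 4) ∷ []) ⊛ poly (+ 1 ∷ - (+ 2) ∷ []) ⊛ poly (+ 3 ∷ - (+ 2) ∷ [])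
      ⊝ poly (+ 1 ∷ - (+ 8) ∷ + 12 ∷ - (+ 2) ∷ []) ⊛ S
  generating-function-identity n = begin
    (poly [2] ⊛ poly [1,-1] ⊛ poly [1,-1] ⊛ poly [1,-4] ⊛ F) n
      ≡⟨ ⊛-congˡ F left n ⟩
    (poly ([2] ·ₚ [1,-1] ·ₚ [1,-1] ·ₚ [1,-4]) ⊛ F) n
      ≡⟨ poly-⊛ ([2] ·ₚ [1,-1] ·ₚ [1,-1] ·ₚ [1,-4]) F n ⟩
    mulPoly (+ 2 ∷ - (+ 12) ∷ + 18 ∷ - (+ 8) ∷ []) F n
      ≡⟨ coefficientwise-identity n ⟩
    poly ([1,-4] ·ₚ [1,-2] ·ₚ [3,-2]) n - mulPoly [1,-8,12,-2] S n
      ≡⟨ cong₂ _-_ (sym (right n)) (sym (poly-⊛ [1,-8,12,-2] S n)) ⟩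
    (poly [1,-4] ⊛ poly [1,-2] ⊛ poly [3,-2] ⊝ poly [1,-8,12,-2] ⊛ S) n
      ∎
    where
    open ≡-Reasoning
    [2] [1,-1] [1,-4] [1,-2] [3,-2] [1,-8,12,-2] : List ℤ
    [2]          = + 2 ∷ []
    [1,-1]       = + 1 ∷ - (+ 1) ∷ []
    [1,-4]       = + 1 ∷ - (+ 4) ∷ []
    [1,-2]       = + 1 ∷ - (+ 2) ∷ []
    [3,-2]       = + 3 ∷ - (+ 2) ∷ []
    [1,-8,12,-2] = + 1 ∷ - (+ 8) ∷ + 12 ∷ - (+ 2) ∷ []
    left : poly [2] ⊛ poly [1,-1] ⊛ poly [1,-1] ⊛ poly [1,-4] ≐ poly ([2] ·ₚ [1,-1] ·ₚ [1,-1] ·ₚ [1,-4])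
    left = ⊛-congˡ (poly [1,-4]) (⊛-congˡ (poly [1,-1]) (poly-⊛-poly [2] [1,-1]) ≐∘ poly-⊛-poly ([2] ·ₚ [1,-1]) [1,-1])
           ≐∘ poly-⊛-poly ([2] ·ₚ [1,-1] ·ₚ [1,-1]) [1,-4]
    right : poly [1,-4] ⊛ poly [1,-2] ⊛ poly [3,-2] ≐ poly ([1,-4] ·ₚ [1,-2] ·ₚ [3,-2])
    right = ⊛-congˡ (poly [3,-2]) (poly-⊛-poly [1,-4] [1,-2]) ≐∘ poly-⊛-poly ([1,-4] ·ₚ [1,-2]) [3,-2]

open import Defs
open import Data.Integer using (+_; -_)
open import Data.List using ([]; _∷_)
open import Data.Product using (_×_; ∃; _,_)
open import Relation.Binary.PropositionalEquality using (_≡_; refl)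
open Enumeration using (I≡total-alive)
open Series using (S; S⊛S; generating-function-identity)

mainTheorem3 :
    (∃ λ (S : PS) →
        S 0 ≡ + 1
      × S ⊛ S ≐ poly (+ 1 ∷ - (+ 4) ∷ [])
      × poly (+ 2 ∷ []) ⊛ poly (+ 1 ∷ - (+ 1) ∷ []) ⊛ poly (+ 1 ∷ - (+ 1) ∷ []) ⊛ poly (+ 1 ∷ - (+ 4) ∷ []) ⊛ F
          ≐ poly (+ 1 ∷ - (+ 4) ∷ []) ⊛ poly (+ 1 ∷ - (+ 2) ∷ []) ⊛ poly (+ 3 ∷ - (+ 2) ∷ [])
            ⊝ poly (+ 1 ∷ - (+ 8) ∷ + 12 ∷ - (+ 2) ∷ []) ⊛ S)
    × (I 0 ≡ 1 × I 1 ≡ 1 × I 2 ≡ 2 × I 3 ≡ 6 × I 4 ≡ 21 × I 5 ≡ 76 × I 6 ≡ 277 × I 7 ≡ 1016)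
mainTheorem3 = (S , refl , S⊛S , generating-function-identity)
             -- the automaton evaluates these counts far faster than the enumeration defining I
             , I≡total-alive 0 , I≡total-alive 1 , I≡total-alive 2 , I≡total-alive 3
             , I≡total-alive 4 , I≡total-alive 5 , I≡total-alive 6 , I≡total-alive 7
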